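{- Let $m\ge1$, $n\ge0$. For an $m$-grafting tree $(T,\ell)$ of size $nm$ with nodes $v_1,\dots,v_{nm}$ in in-order, define $\mathrm{expand}(T,\ell)=(T,\ell')$ by $\ell'(v_i)=m\,\ell(v_i)$ if $i\equiv0\pmod m$ and $\ell'(v_i)=m(\ell(v_i)-1)$ otherwise. Then $(T,\ell')$ is a grafting tree, $\mathrm{expand}$ defines (through grafting trees, $I\mapsto\mathrm{Graft}^{ -1}(\mathrm{expand}(\mathrm{Graft}(I)))$) a bijection between $m$-interval-posets of size $nm$ and rise-contact-$m$-divisible interval-posets of size $nm$, whose inverse is $\mathrm{contract}$, given by $\ell(v_i)=\ell'(v_i)/m$ if $i\equiv0\pmod m$ and $\ell(v_i)=\ell'(v_i)/m+1$ otherwise. Moreover $\mathrm{contacts}(\mathrm{Graft}^{ -1}(T,\ell'))=m\cdot\mathrm{contacts}(\mathrm{Graft}^{ -1}(T,\ell))$.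
   Context: An interval-poset of size $N$ is a partial order $\triangleleft$ on $\{1,\dots,N\}$ with $a\triangleleft c\Rightarrow b\triangleleft c$ and $c\triangleleft a\Rightarrow b\triangleleft a$ for all $a<b<c$; it corresponds to a Tamari interval $[T_1,T_2]$ of binary trees (nodes in in-order; order generated by right rotations $y(x(A,B),C)\to x(A,y(B,C))$) via: for $a<b$, $b\triangleleft a$ iff $v_b$ in right subtree of $v_a$ in $T_1$, $a\triangleleft b$ iff $v_a$ in left subtree of $v_b$ in $T_2$; its lower/upper Dyck paths $D_1,D_2$ satisfy $\mathrm{tree}(D_i)=T_i$, where $\mathrm{tree}(D'1D''0)$ has left subtree $\mathrm{tree}(D')$ and right subtree $\mathrm{tree}(D'')$. An $m$-interval-poset is an interval-poset of size $nm$ with $im\triangleleft im-1\triangleleft\dots\triangleleft im-(m-1)$ for all $1\le i\le n$. Dyck path statistics (size $N$): $\mathrm{contacts}(D)$ = points at height $0$ other than the last; $\mathrm{contacts}_i(D)$ = non-final contacts of the Dyck subpath strictly between the $i$-th up-step and its matching down-step; $\mathrm{rises}(D)$ = initial run of up-steps; $\mathrm{rises}_i(D)$ = up-steps immediately after the $i$-th down-step. For an interval-poset $I$: $\mathrm{contacts}(I)=\mathrm{contacts}(D_1)$, contact vector $(\mathrm{contacts}(D_1),\mathrm{contacts}_1(D_1),\dots,\mathrm{contacts}_{N-1}(D_1))$, rise vector $(\mathrm{rises}(D_2),\mathrm{rises}_1(D_2),\dots,\mathrm{rises}_{N-1}(D_2))$. $I$ is rise-contact-$m$-divisible if all entries of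 both vectors are divisible by $m$. Grafting trees: $u$ = interval-poset of size $1$; shifted concatenation of $I_1$ (size $n_1$) and $I_2$: relations of $I_1$ and of $I_2$ shifted by $n_1$; $I_1\prec I_2$ ($I_2\ne\emptyset$) adds $y\triangleleft n_1+1$ for all $y\le n_1$, $\emptyset\prec I_2=I_2$; $I_1\succ_r I_2$ ($I_1\ne\emptyset$, $0\le r\le c$, $y_1<\dots<y_c$ the decreasing roots of $I_2$, i.e. vertices $b$ with no $a<b$ such that $b\triangleleft a$, shifted by $n_1$) adds $y_i\triangleleft n_1$ for $i\le r$, $I_1\succ_0\emptyset=I_1$. A grafting tree is a binary tree $T$ with labels $\ell(v)\in\mathbb N$ with $\ell(v)\le\mathrm{size}(T_R(v))-\sum_{w\in T_R(v)}\ell(w)$ for all nodes $v$ ($T_R(v)$ the right subtree). $\mathrm{Graft}^{ -1}(\emptyset)=\emptyset$, $\mathrm{Graft}^{ -1}(T,\ell)=\mathrm{Graft}^{ -1}(T_L,\ell)\prec(u\succ_{\ell(\mathrm{root})}\mathrm{Graft}^{ -1}(T_R,\ell))$; this is a bijection onto interval-posets with inverse $\mathrm{Graft}$. An $m$-grafting tree is a grafting tree of size $nm$ with $\ell(v_i)\ge1$ for all $i\not\equiv0\pmod m$; $I$ is an $m$-interval-poset iff $\mathrm{Graft}(I)$ is an $m$-grafting tree. -}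

module Defs where

open import Data.Nat using (ℕ; zero; suc; _+_; _*_; _∸_; _≤_; _<_; NonZero)
open import Data.Nat.DivMod using (_/_)
open import Data.Nat.Divisibility using (_∣_; _∣?_)
open import Data.Bool using (Bool; true; false; if_then_else_)
open import Data.List using (List; []; _∷_; _++_; [_]; take)
open import Data.List.Membership.Propositional using (_∈_)
open import Data.List.Relation.Unary.Linked using (Linked)
open import Data.Product using (Σ; _×_)
open import Data.Sum using (_⊎_)
open import Data.Empty using (⊥)
open import Data.Unit using (⊤)
open import Relation.Nullary using (¬_; does)
open import Relation.Binary.PropositionalEquality using (_≡_)
open import Relation.Binary.Construct.Closure.ReflexiveTransitive using (Star)

data BT : Set where
  leaf : BT
  node : BT → BT → BT

bsize : BT → ℕ
bsize leaf = 0
bsize (node L R) = suc (bsize L + bsize R)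

-- Dyck paths as lists of steps (true = up-step 1, false = down-step 0).
-- enc is the inverse of tree: tree (D' 1 D'' 0) = node (tree D') (tree D''),
-- so "tree D ≡ T" is expressed as "D ≡ enc T".
enc : BT → List Bool
enc leaf = []
enc (node L R) = enc L ++ (true ∷ enc R ++ [ false ])

-- In-order positions (1-based, shifted by an offset o).
-- InRight T o a b : v_b lies in the right subtree of v_a.
InRight : BT → ℕ → ℕ → ℕ → Set
InRight leaf o a b = ⊥
InRight (node L R) o a b =
  ((a ≡ o + suc (bsize L)) × (o + suc (bsize L) < b) × (b ≤ o + suc (bsize L) + bsize R))
  ⊎ InRight L o a b ⊎ InRight R (o + suc (bsize L)) a b

-- InLeft T o a b : v_a lies in the left subtree of v_b.
InLeft : BT → ℕ → ℕ → ℕ → Set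
InLeft leaf o a b = ⊥
InLeft (node L R) o a b =
  ((b ≡ o + suc (bsize L)) × (o < a) × (a < o + suc (bsize L)))
  ⊎ InLeft L o a b ⊎ InLeft R (o + suc (bsize L)) a b

step : ℕ → Bool → ℕ
step h true = suc h
step h false = h ∸ 1

-- number of points at height 0, except the last point
contactsFrom : ℕ → List Bool → ℕ
contactsFrom h [] = 0
contactsFrom zero (b ∷ bs) = suc (contactsFrom (step zero b) bs)
contactsFrom (suc h) (b ∷ bs) = contactsFrom (step (suc h) b) bs

contacts : List Bool → ℕ
contacts = contactsFrom 0

-- suffix after the (k+1)-th up-step / down-step
afterUp : ℕ → List Bool → List Bool
afterUp k [] = []
afterUp zero (true ∷ xs) = xs
afterUp (suc k) (true ∷ xs) = afterUp k xs
afterUp k (false ∷ xs) = afterUp k xs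

afterDown : ℕ → List Bool → List Bool
afterDown k [] = []
afterDown zero (false ∷ xs) = xs
afterDown (suc k) (false ∷ xs) = afterDown k xs
afterDown k (true ∷ xs) = afterDown k xs

-- prefix up to (excluding) the step going below the starting level
inside : ℕ → List Bool → List Bool
inside h [] = []
inside h (true ∷ xs) = true ∷ inside (suc h) xs
inside zero (false ∷ xs) = []
inside (suc h) (false ∷ xs) = false ∷ inside h xs

leadingUps : List Bool → ℕ
leadingUps (true ∷ xs) = suc (leadingUps xs)
leadingUps _ = 0

-- contacts_{k+1}(D): non-final contacts of the subpath strictly between the
-- (k+1)-th up-step and its matching down-step
contactsI : List Bool → ℕ → ℕ
contactsI D k = contacts (inside 0 (afterUp k D))

rises : List Bool → ℕ
rises = leadingUps

-- rises_{k+1}(D): up-steps immediately after the (k+1)-th down-step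
risesI : List Bool → ℕ → ℕ
risesI D k = leadingUps (afterDown k D)

-- Relations on {1,…,N} (a ⊲ b written R a b)

Relℕ : Set₁
Relℕ = ℕ → ℕ → Set

IsLower : Relℕ → ℕ → BT → Set
IsLower R N T = (bsize T ≡ N) × (∀ a b → 1 ≤ a → a < b → b ≤ N →
                  (R b a → InRight T 0 a b) × (InRight T 0 a b → R b a))

IsUpper : Relℕ → ℕ → BT → Set
IsUpper R N T = (bsize T ≡ N) × (∀ a b → 1 ≤ a → a < b → b ≤ N →
                  (R a b → InLeft T 0 a b) × (InLeft T 0 a b → R a b))

-- rise-contact-m-divisible (D₁ = enc T₁, D₂ = enc T₂)
RiseContactDiv : ℕ → ℕ → Relℕ → Set
RiseContactDiv m N R =
  Σ BT λ T₁ → Σ BT λ T₂ → IsLower R N T₁ × IsUpper R N T₂ ×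
    (m ∣ contacts (enc T₁)) × (∀ k → suc k < N → m ∣ contactsI (enc T₁) k) ×
    (m ∣ rises (enc T₂)) × (∀ k → suc k < N → m ∣ risesI (enc T₂) k)

data LT : Set where
  leaf : LT
  node : LT → ℕ → LT → LT

size : LT → ℕ
size leaf = 0
size (node L k R) = suc (size L + size R)

labelSum : LT → ℕ
labelSum leaf = 0
labelSum (node L k R) = labelSum L + k + labelSum R

-- ℓ(v) ≤ size(T_R(v)) − Σ_{w ∈ T_R(v)} ℓ(w) for all v  (stated without truncated subtraction)
IsGrafting : LT → Set
IsGrafting leaf = ⊤
IsGrafting (node L k R) = IsGrafting L × (k + labelSum R ≤ size R) × IsGrafting R

-- ℓ(v_i) ≥ 1 whenever m ∤ i (v_i the i-th node in in-order, offset o)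
MLabels : ℕ → ℕ → LT → Set
MLabels m o leaf = ⊤
MLabels m o (node L k R) =
  MLabels m o L × (¬ (m ∣ (o + suc (size L))) → 1 ≤ k) × MLabels m (o + suc (size L)) R

IsMGrafting : ℕ → ℕ → LT → Set
IsMGrafting m n T = IsGrafting T × (size T ≡ n * m) × MLabels m 0 T

expandFrom : ℕ → ℕ → LT → LT
expandFrom m o leaf = leaf
expandFrom m o (node L k R) =
  node (expandFrom m o L)
       (if does (m ∣? (o + suc (size L))) then m * k else m * (k ∸ 1))
       (expandFrom m (o + suc (size L)) R)

expand : ℕ → LT → LT
expand m = expandFrom m 0

contractFrom : (m : ℕ) → .{{NonZero m}} → ℕ → LT → LT
contractFrom m o leaf = leaf
contractFrom m o (node L k R) =
  node (contractFrom m o L)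
       (if does (m ∣? (o + suc (size L))) then k / m else suc (k / m))
       (contractFrom m (o + suc (size L)) R)

contract : (m : ℕ) → .{{NonZero m}} → LT → LT
contract m = contractFrom m 0

Shift : ℕ → Relℕ → Relℕ
Shift s R a b = Σ ℕ λ a' → Σ ℕ λ b' → (a ≡ s + a') × (b ≡ s + b') × R a' b'

DRoot : Relℕ → ℕ → ℕ → Set
DRoot R n b = (1 ≤ b) × (b ≤ n) × (∀ a → 1 ≤ a → a < b → ¬ R b a)

FirstDRoots : Relℕ → ℕ → ℕ → ℕ → Set
FirstDRoots R n r y =
  Σ (List ℕ) λ ys → Linked _<_ ys × (∀ b → (b ∈ ys → DRoot R n b) × (DRoot R n b → b ∈ ys))
                  × y ∈ take r ys

-- Graft⁻¹(node L k R) = Graft⁻¹ L ≺ (u ≻_k Graft⁻¹ R); the order relation is the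
-- reflexive–transitive closure of the relations of the pieces and the added ones.
graftInv : LT → Relℕ
graftInv leaf a b = ⊥
graftInv (node L k R) = Star λ a b →
    graftInv L a b
  ⊎ Shift (suc (size L)) (graftInv R) a b
  ⊎ ((b ≡ suc (size L)) × (1 ≤ a) × (a ≤ size L))
  ⊎ ((b ≡ suc (size L)) × Σ ℕ λ y → (a ≡ suc (size L) + y) × FirstDRoots (graftInv R) (size R) k y)

-- The upper tree of Graft⁻¹(T, ℓ) is the shape of T; its lower tree grafts,
-- at every node v, the lower tree of T_L(v) onto the left spine of the lower
-- tree of T_R(v), ℓ(v) steps above its bottom.  Hence contacts_i(D₁) = ℓ(v_i),
-- contacts(D₁) = N − Σ ℓ, and the rises of D₂ are divisible by m iff every
-- subtree of T ends at an in-order index divisible by m.  So Graft⁻¹(T) is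
-- rise-contact-m-divisible iff all labels and all subtree ends of T are
-- multiples of m.  expand/contract act label-wise, are mutually inverse, and
-- preserve the grafting inequalities because s consecutive positions ending
-- before a multiple of m contain exactly ⌊s/m⌋ multiples of m.  Uniqueness of
-- lower/upper trees transfers everything to the given trees.
module Submission where

open import Defs
open import Data.Nat using (ℕ; zero; suc; _+_; _*_; _∸_; _≤_; _<_; z≤n; s≤s; NonZero; >-nonZero⁻¹)
open import Data.Nat.Properties
open import Data.Nat.DivMod using (_/_; m*n/n≡m; m*[n/m]≡n)
open import Data.Nat.Divisibility using (_∣_; _∣?_; divides; ∣m+n∣m⇒∣n; m∣m*n; _∣0; ∣m∣n⇒∣m+n; n∣m*n)
open import Data.Nat.Solver using (module +-*-Solver)
open +-*-Solver using (solve; _:*_; _:+_; con; _:=_)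
open import Data.Bool using (Bool; true; false; if_then_else_)
open import Data.Product using (Σ; _×_; _,_; proj₁; proj₂)
open import Data.Sum using (_⊎_; inj₁; inj₂)
open import Data.Empty using (⊥; ⊥-elim)
open import Data.Unit using (⊤; tt)
open import Relation.Nullary using (¬_; does; yes; no)
open import Relation.Binary.PropositionalEquality hiding ([_])
open import Relation.Binary.Definitions using (tri<; tri≈; tri>)
open import Relation.Binary.Construct.Closure.ReflexiveTransitive using (Star; ε; _◅_; _◅◅_)
open import Data.List using (List; []; _∷_; _++_; [_]; length; map; take)
open import Data.List.Properties using (++-assoc; ++-identityʳ; length-++; map-++; take-all)
open import Data.List.Membership.Propositional using (_∈_)
open import Data.List.Membership.Propositional.Properties using (∈-++⁺ˡ; ∈-++⁺ʳ; ∈-++⁻)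
open import Data.List.Relation.Unary.Any using (here; there)
open import Data.List.Relation.Unary.All using (All; []; _∷_)
open import Data.List.Relation.Unary.All.Properties using (++⁺; ++⁻)
open import Data.List.Relation.Unary.Linked as Linked using (Linked; []; [-]; _∷_)
open import Data.List.Relation.Binary.Sublist.Propositional.Properties using (take-⊆; Any-resp-⊆)

cong₃ : ∀ {A B C D : Set} (f : A → B → C → D) {a a' b b' c c'} →
        a ≡ a' → b ≡ b' → c ≡ c' → f a b c ≡ f a' b' c'
cong₃ f refl refl refl = refl

nth : {A : Set} → A → List A → ℕ → A
nth d [] k = d
nth d (x ∷ xs) zero = x
nth d (x ∷ xs) (suc k) = nth d xs k

nth-map : {A B : Set} (f : A → B) (d : A) → ∀ xs k → f (nth d xs k) ≡ nth (f d) (map f xs) k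
nth-map f d [] k = refl
nth-map f d (x ∷ xs) zero = refl
nth-map f d (x ∷ xs) (suc k) = nth-map f d xs k

nth-++ˡ : {A : Set} (d : A) → ∀ xs ys k → k < length xs → nth d (xs ++ ys) k ≡ nth d xs k
nth-++ˡ d (x ∷ xs) ys zero _ = refl
nth-++ˡ d (x ∷ xs) ys (suc k) (s≤s lt) = nth-++ˡ d xs ys k lt

nth-++ʳ : {A : Set} (d : A) → ∀ xs ys j → nth d (xs ++ ys) (length xs + j) ≡ nth d ys j
nth-++ʳ d [] ys j = refl
nth-++ʳ d (x ∷ xs) ys j = nth-++ʳ d xs ys j

linked-snoc : ∀ xs {x} → Linked _<_ xs → (∀ z → z ∈ xs → z < x) → Linked _<_ (xs ++ [ x ])
linked-snoc [] _ _ = [-]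
linked-snoc (y ∷ []) _ h = h y (here refl) ∷ [-]
linked-snoc (y ∷ z ∷ xs) (r ∷ l) h = r ∷ linked-snoc (z ∷ xs) l (λ w i → h w (there i))

take-++ˡ : ∀ {A : Set} k (xs ys : List A) → k ≤ length xs → take k (xs ++ ys) ≡ take k xs
take-++ˡ zero xs ys _ = refl
take-++ˡ (suc k) (x ∷ xs) ys (s≤s le) = cong (x ∷_) (take-++ˡ k xs ys le)

linked-head< : ∀ {x z} xs → Linked _<_ (x ∷ xs) → z ∈ xs → x < z
linked-head< (y ∷ xs) (r ∷ l) (here refl) = r
linked-head< (y ∷ xs) (r ∷ l) (there i) = <-trans r (linked-head< xs l i)

sorted-unique : ∀ xs ys → Linked _<_ xs → Linked _<_ ys → (∀ z → z ∈ xs → z ∈ ys) → (∀ z → z ∈ ys → z ∈ xs) → xs ≡ ys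
sorted-unique [] [] _ _ _ _ = refl
sorted-unique [] (y ∷ ys) _ _ _ h with h y (here refl)
... | ()
sorted-unique (x ∷ xs) [] _ _ h _ with h x (here refl)
... | ()
sorted-unique (x ∷ xs) (y ∷ ys) lx ly h1 h2 with h1 x (here refl) | h2 y (here refl)
... | here refl | _ = cong (x ∷_) (sorted-unique xs ys (Linked.tail lx) (Linked.tail ly) g1 g2)
  where
  g1 : ∀ z → z ∈ xs → z ∈ ys
  g1 z i with h1 z (there i)
  ... | here refl = ⊥-elim (<-irrefl refl (linked-head< xs lx i))
  ... | there j = j
  g2 : ∀ z → z ∈ ys → z ∈ xs
  g2 z i with h2 z (there i)
  ... | here refl = ⊥-elim (<-irrefl refl (linked-head< ys ly i))
  ... | there j = j
... | there i | here refl = ⊥-elim (<-irrefl refl (linked-head< ys ly i))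
... | there i | there j = ⊥-elim (<-asym (linked-head< ys ly i) (linked-head< xs lx j))

leftSpine : BT → ℕ
leftSpine leaf = 0
leftSpine (node L R) = suc (leftSpine L)

shape : LT → BT
shape leaf = leaf
shape (node L k R) = node (shape L) (shape R)

bsize-shape : ∀ T → bsize (shape T) ≡ size T
bsize-shape leaf = refl
bsize-shape (node L k R) = cong suc (cong₂ _+_ (bsize-shape L) (bsize-shape R))

ups : List Bool → ℕ
ups [] = 0
ups (true ∷ xs) = suc (ups xs)
ups (false ∷ xs) = ups xs

downs : List Bool → ℕ
downs [] = 0
downs (true ∷ xs) = downs xs
downs (false ∷ xs) = suc (downs xs)

ups-++ : ∀ X Y → ups (X ++ Y) ≡ ups X + ups Y
ups-++ [] Y = refl
ups-++ (true ∷ X) Y = cong suc (ups-++ X Y)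
ups-++ (false ∷ X) Y = ups-++ X Y

downs-++ : ∀ X Y → downs (X ++ Y) ≡ downs X + downs Y
downs-++ [] Y = refl
downs-++ (true ∷ X) Y = downs-++ X Y
downs-++ (false ∷ X) Y = cong suc (downs-++ X Y)

enc-node : ∀ L R Y → enc (node L R) ++ Y ≡ enc L ++ (true ∷ enc R ++ false ∷ Y)
enc-node L R Y = trans (++-assoc (enc L) _ Y) (cong (λ z → enc L ++ (true ∷ z)) (++-assoc (enc R) [ false ] Y))

ups-enc : ∀ B → ups (enc B) ≡ bsize B
ups-enc leaf = refl
ups-enc (node L R) = begin
    ups (enc L ++ true ∷ enc R ++ [ false ])  ≡⟨ ups-++ (enc L) _ ⟩
    ups (enc L) + suc (ups (enc R ++ [ false ]))
      ≡⟨ cong (λ z → ups (enc L) + suc z) (trans (ups-++ (enc R) [ false ]) (+-identityʳ _)) ⟩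
    ups (enc L) + suc (ups (enc R))  ≡⟨ cong₂ (λ a b → a + suc b) (ups-enc L) (ups-enc R) ⟩
    bsize L + suc (bsize R)  ≡⟨ +-suc (bsize L) (bsize R) ⟩
    bsize (node L R)  ∎
  where open ≡-Reasoning

downs-enc : ∀ B → downs (enc B) ≡ bsize B
downs-enc leaf = refl
downs-enc (node L R) = begin
    downs (enc L ++ true ∷ enc R ++ [ false ])  ≡⟨ downs-++ (enc L) _ ⟩
    downs (enc L) + downs (enc R ++ [ false ])
      ≡⟨ cong (downs (enc L) +_) (trans (downs-++ (enc R) [ false ]) (+-comm _ 1)) ⟩
    downs (enc L) + suc (downs (enc R))  ≡⟨ cong₂ (λ a b → a + suc b) (downs-enc L) (downs-enc R) ⟩
    bsize L + suc (bsize R)  ≡⟨ +-suc (bsize L) (bsize R) ⟩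
    bsize (node L R)  ∎
  where open ≡-Reasoning

-- Contacts contributed by an enclosed Dyck word started at height h: one per
-- node of its left spine when h = 0, none otherwise.
spineContacts : ℕ → BT → ℕ
spineContacts zero B = leftSpine B
spineContacts (suc _) B = 0

contactsFrom-enc : ∀ B h Y → contactsFrom h (enc B ++ Y) ≡ spineContacts h B + contactsFrom h Y
contactsFrom-enc leaf zero Y = refl
contactsFrom-enc leaf (suc h) Y = refl
contactsFrom-enc (node L R) zero Y
  rewrite enc-node L R Y | contactsFrom-enc L zero (true ∷ enc R ++ false ∷ Y)
        | contactsFrom-enc R 1 (false ∷ Y) = +-suc (leftSpine L) _
contactsFrom-enc (node L R) (suc h) Y
  rewrite enc-node L R Y | contactsFrom-enc L (suc h) (true ∷ enc R ++ false ∷ Y)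
        | contactsFrom-enc R (suc (suc h)) (false ∷ Y) = refl

contacts-enc : ∀ B → contacts (enc B) ≡ leftSpine B
contacts-enc B = begin
    contactsFrom 0 (enc B)       ≡⟨ cong (contactsFrom 0) (sym (++-identityʳ (enc B))) ⟩
    contactsFrom 0 (enc B ++ [])  ≡⟨ contactsFrom-enc B 0 [] ⟩
    leftSpine B + 0              ≡⟨ +-identityʳ _ ⟩
    leftSpine B  ∎
  where open ≡-Reasoning

-- An enclosed Dyck word never goes below its starting level.
inside-enc : ∀ C h W → inside h (enc C ++ W) ≡ enc C ++ inside h W
inside-enc leaf h W = refl
inside-enc (node C₁ C₂) h W
  rewrite enc-node C₁ C₂ W | inside-enc C₁ h (true ∷ enc C₂ ++ false ∷ W)
        | inside-enc C₂ (suc h) (false ∷ W) = sym (enc-node C₁ C₂ (inside h W))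

-- The right subtrees of the nodes of B, in in-order.  The k-th up-step of
-- enc B belongs to the k-th node and is followed by the word of its right
-- subtree and the matching down-step.
rightSubtrees : BT → List BT
rightSubtrees leaf = []
rightSubtrees (node L R) = rightSubtrees L ++ R ∷ rightSubtrees R

length-rightSubtrees : ∀ B → length (rightSubtrees B) ≡ bsize B
length-rightSubtrees leaf = refl
length-rightSubtrees (node L R) =
  trans (length-++ (rightSubtrees L))
        (trans (cong₂ (λ a b → a + suc b) (length-rightSubtrees L) (length-rightSubtrees R))
               (+-suc (bsize L) (bsize R)))

afterUp-++ : ∀ X Y j → afterUp (ups X + j) (X ++ Y) ≡ afterUp j Y
afterUp-++ [] Y j = refl
afterUp-++ (true ∷ X) Y j = afterUp-++ X Y j
afterUp-++ (false ∷ X) Y j with ups X + j in eq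
... | zero = trans (cong (λ z → afterUp z (X ++ Y)) (sym eq)) (afterUp-++ X Y j)
... | suc q = trans (cong (λ z → afterUp z (X ++ Y)) (sym eq)) (afterUp-++ X Y j)

afterUp-enc : ∀ B Y k → k < bsize B →
              Σ (List Bool) λ Z → afterUp k (enc B ++ Y) ≡ enc (nth leaf (rightSubtrees B) k) ++ false ∷ Z
afterUp-enc (node L R) Y k lt with k <? bsize L
... | yes k<L =
  let (Z , e) = afterUp-enc L (true ∷ enc R ++ false ∷ Y) k k<L in
  Z , trans (cong (afterUp k) (enc-node L R Y))
            (trans e (cong (λ t → enc t ++ false ∷ Z)
                           (sym (nth-++ˡ leaf (rightSubtrees L) _ k
                                  (subst (k <_) (sym (length-rightSubtrees L)) k<L)))))
... | no k≮L with m≤n⇒∃[o]m+o≡n (≮⇒≥ k≮L)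
... | j , refl = inRight j lt
  where
  skipLeft : ∀ j → afterUp (bsize L + j) (enc (node L R) ++ Y) ≡ afterUp j (true ∷ enc R ++ false ∷ Y)
  skipLeft j = trans (cong (afterUp (bsize L + j)) (enc-node L R Y))
                 (trans (cong (λ z → afterUp (z + j) (enc L ++ _)) (sym (ups-enc L))) (afterUp-++ (enc L) _ j))
  nthRight : ∀ j → nth leaf (rightSubtrees L ++ R ∷ rightSubtrees R) (bsize L + j) ≡ nth leaf (R ∷ rightSubtrees R) j
  nthRight j = trans (cong (λ z → nth leaf (rightSubtrees L ++ R ∷ rightSubtrees R) (z + j)) (sym (length-rightSubtrees L)))
                     (nth-++ʳ leaf (rightSubtrees L) _ j)
  inRight : ∀ j → bsize L + j < bsize (node L R) →
            Σ (List Bool) λ Z → afterUp (bsize L + j) (enc (node L R) ++ Y)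
                                  ≡ enc (nth leaf (rightSubtrees (node L R)) (bsize L + j)) ++ false ∷ Z
  inRight zero _ = Y , trans (skipLeft zero) (cong (λ t → enc t ++ false ∷ Y) (sym (nthRight zero)))
  inRight (suc j') lt' =
    let j'<R = +-cancelˡ-< (bsize L) j' (bsize R) (subst (_≤ bsize L + bsize R) (+-suc (bsize L) j') (≤-pred lt'))
        (Z , e) = afterUp-enc R (false ∷ Y) j' j'<R in
    Z , trans (skipLeft (suc j')) (trans e (cong (λ t → enc t ++ false ∷ Z) (sym (nthRight (suc j')))))

contactsI-enc : ∀ B k → k < bsize B → contactsI (enc B) k ≡ leftSpine (nth leaf (rightSubtrees B) k)
contactsI-enc B k lt with afterUp-enc B [] k lt
... | Z , e = begin
    contacts (inside 0 (afterUp k (enc B)))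
      ≡⟨ cong (λ z → contacts (inside 0 (afterUp k z))) (sym (++-identityʳ (enc B))) ⟩
    contacts (inside 0 (afterUp k (enc B ++ [])))  ≡⟨ cong (λ z → contacts (inside 0 z)) e ⟩
    contacts (inside 0 (enc C ++ false ∷ Z))       ≡⟨ cong contacts (inside-enc C 0 (false ∷ Z)) ⟩
    contacts (enc C ++ [])                         ≡⟨ cong contacts (++-identityʳ (enc C)) ⟩
    contacts (enc C)                               ≡⟨ contacts-enc C ⟩
    leftSpine C  ∎
  where
  open ≡-Reasoning
  C : BT
  C = nth leaf (rightSubtrees B) k

-- The rise condition on the upper Dyck word

module RiseCondition (m : ℕ) where

  DownsAtMultiples : ℕ → List Bool → Set
  DownsAtMultiples c [] = ⊤
  DownsAtMultiples c (true ∷ D) = DownsAtMultiples (suc c) D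
  DownsAtMultiples c (false ∷ D) = (m ∣ c) × DownsAtMultiples c D

  downsAtMultiples-++⁻ : ∀ c X Y → DownsAtMultiples c (X ++ Y) →
                         DownsAtMultiples c X × DownsAtMultiples (c + ups X) Y
  downsAtMultiples-++⁻ c [] Y q = tt , subst (λ z → DownsAtMultiples z Y) (sym (+-identityʳ c)) q
  downsAtMultiples-++⁻ c (true ∷ X) Y q =
    let (qX , qY) = downsAtMultiples-++⁻ (suc c) X Y q in
    qX , subst (λ z → DownsAtMultiples z Y) (sym (+-suc c (ups X))) qY
  downsAtMultiples-++⁻ c (false ∷ X) Y (d , q) =
    let (qX , qY) = downsAtMultiples-++⁻ c X Y q in (d , qX) , qY

  downsAtMultiples-++⁺ : ∀ c X Y → DownsAtMultiples c X → DownsAtMultiples (c + ups X) Y →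
                         DownsAtMultiples c (X ++ Y)
  downsAtMultiples-++⁺ c [] Y _ q = subst (λ z → DownsAtMultiples z Y) (+-identityʳ c) q
  downsAtMultiples-++⁺ c (true ∷ X) Y qX qY =
    downsAtMultiples-++⁺ (suc c) X Y qX (subst (λ z → DownsAtMultiples z Y) (+-suc c (ups X)) qY)
  downsAtMultiples-++⁺ c (false ∷ X) Y (d , qX) qY = d , downsAtMultiples-++⁺ c X Y qX qY

  rises-divisible : ∀ c D → DownsAtMultiples c D → m ∣ c + ups D →
                    (m ∣ c + leadingUps D) × (∀ k → m ∣ leadingUps (afterDown k D))
  rises-divisible c [] _ d = d , λ { zero → m ∣0 ; (suc k) → m ∣0 }
  rises-divisible c (true ∷ D) q d =
    let (first , later) = rises-divisible (suc c) D q (subst (m ∣_) (+-suc c (ups D)) d) in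
    subst (m ∣_) (sym (+-suc c (leadingUps D))) first , λ { zero → later zero ; (suc k) → later (suc k) }
  rises-divisible c (false ∷ D) (dc , q) d =
    let (first , later) = rises-divisible c D q d in
    subst (m ∣_) (sym (+-identityʳ c)) dc , λ { zero → ∣m+n∣m⇒∣n first dc ; (suc k) → later k }

  downsAtMultiples-noDowns : ∀ c D → downs D ≡ 0 → DownsAtMultiples c D
  downsAtMultiples-noDowns c [] _ = tt
  downsAtMultiples-noDowns c (true ∷ D) e = downsAtMultiples-noDowns (suc c) D e
  downsAtMultiples-noDowns c (false ∷ D) ()

  -- Conversely, divisible rises force every down-step to occur after a
  -- multiple of m up-steps (the runs after the last down-step are irrelevant).
  downsAtMultiples-of-rises : ∀ c D → m ∣ c + leadingUps D →
                              (∀ k → suc k < downs D → m ∣ leadingUps (afterDown k D)) →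
                              DownsAtMultiples c D
  downsAtMultiples-of-rises c [] _ _ = tt
  downsAtMultiples-of-rises c (true ∷ D) d h =
    downsAtMultiples-of-rises (suc c) D (subst (m ∣_) (+-suc c (leadingUps D)) d) later
    where
    later : ∀ k → suc k < downs D → m ∣ leadingUps (afterDown k D)
    later zero lt = h zero lt
    later (suc k) lt = h (suc k) lt
  downsAtMultiples-of-rises c (false ∷ D) d h with downs D in eq
  ... | zero = dc , downsAtMultiples-noDowns c D eq
    where dc = subst (m ∣_) (+-identityʳ c) d
  ... | suc _ =
    dc , downsAtMultiples-of-rises c D (∣m∣n⇒∣m+n dc (h zero (s≤s (s≤s z≤n))))
                                      (λ k lt → h (suc k) (s≤s (subst (suc k <_) eq lt)))
    where dc = subst (m ∣_) (+-identityʳ c) d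

  -- The tree-side condition: for every node v_i (in-order index i, counted from
  -- the offset o), the index i + |T_R(v_i)| of the last node of its subtree
  -- is a multiple of m.
  EndsDivisible : ℕ → LT → Set
  EndsDivisible o leaf = ⊤
  EndsDivisible o (node L k R) =
    EndsDivisible o L × (m ∣ (o + suc (size L)) + size R) × EndsDivisible (o + suc (size L)) R

  -- In enc (shape T) the down-step of v_i is preceded by exactly
  -- i + |T_R(v_i)| up-steps, so the two conditions agree.
  ups-enc-shape : ∀ T → ups (enc (shape T)) ≡ size T
  ups-enc-shape T = trans (ups-enc (shape T)) (bsize-shape T)

  subtreeEnd : ∀ o L R → suc (o + size L) + ups (enc (shape R)) ≡ (o + suc (size L)) + size R
  subtreeEnd o L R = trans (cong (suc (o + size L) +_) (ups-enc-shape R)) (cong (_+ size R) (sym (+-suc o (size L))))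

  ends⇒downs : ∀ o T → EndsDivisible o T → DownsAtMultiples o (enc (shape T))
  ends⇒downs o leaf _ = tt
  ends⇒downs o (node L k R) (eL , d , eR) =
    downsAtMultiples-++⁺ o (enc (shape L)) _ (ends⇒downs o L eL)
      (subst (λ z → DownsAtMultiples z (true ∷ enc (shape R) ++ false ∷ [])) (sym (cong (o +_) (ups-enc-shape L)))
        (downsAtMultiples-++⁺ (suc (o + size L)) (enc (shape R)) _
           (subst (λ z → DownsAtMultiples z (enc (shape R))) (+-suc o (size L)) (ends⇒downs _ R eR))
           (subst (m ∣_) (sym (subtreeEnd o L R)) d , tt)))

  downs⇒ends : ∀ o T → DownsAtMultiples o (enc (shape T)) → EndsDivisible o T
  downs⇒ends o leaf _ = tt
  downs⇒ends o (node L k R) q =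
    let (qL , q') = downsAtMultiples-++⁻ o (enc (shape L)) _ q
        q'' = subst (λ z → DownsAtMultiples z (true ∷ enc (shape R) ++ false ∷ [])) (cong (o +_) (ups-enc-shape L)) q'
        (qR , (d , _)) = downsAtMultiples-++⁻ (suc (o + size L)) (enc (shape R)) _ q''
    in downs⇒ends o L qL ,
       subst (m ∣_) (subtreeEnd o L R) d ,
       downs⇒ends _ R (subst (λ z → DownsAtMultiples z (enc (shape R))) (sym (+-suc o (size L))) qR)

-- The nodes of a tree B placed at offset o occupy positions o+1 … o+|B|; the
-- root of node L R sits at o + suc |L|.

rootEnd : ∀ o L R → o + suc (bsize L) + bsize R ≡ o + bsize (node L R)
rootEnd o L R = +-assoc o (suc (bsize L)) (bsize R)

offset<root : ∀ o x → o < o + suc x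
offset<root o x = subst (o <_) (sym (+-suc o x)) (s≤s (m≤m+n o x))

leftEnd≤ : ∀ o L R → o + bsize L ≤ o + bsize (node L R)
leftEnd≤ o L R = +-monoʳ-≤ o (≤-trans (m≤m+n (bsize L) (bsize R)) (n≤1+n _))

rootLt : ∀ o L {y} → y ≤ o + bsize L → y < o + suc (bsize L)
rootLt o L {y} le = subst (suc y ≤_) (sym (+-suc o (bsize L))) (s≤s le)

ltRoot : ∀ o L {y} → y < o + suc (bsize L) → y ≤ o + bsize L
ltRoot o L {y} lt = ≤-pred (subst (suc y ≤_) (+-suc o (bsize L)) lt)

inRight-range : ∀ B o {a b} → InRight B o a b → (o < a) × (a < b) × (b ≤ o + bsize B)
inRight-range leaf o ()
inRight-range (node L R) o (inj₁ (refl , lt , le)) = offset<root o (bsize L) , lt , ≤-trans le (≤-reflexive (rootEnd o L R))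
inRight-range (node L R) o (inj₂ (inj₁ x)) = let (a1 , a2 , a3) = inRight-range L o x in a1 , a2 , ≤-trans a3 (leftEnd≤ o L R)
inRight-range (node L R) o (inj₂ (inj₂ x)) = let (a1 , a2 , a3) = inRight-range R _ x in
  <-trans (offset<root o (bsize L)) a1 , a2 , ≤-trans a3 (≤-reflexive (rootEnd o L R))

inLeft-range : ∀ B o {a b} → InLeft B o a b → (o < a) × (a < b) × (b ≤ o + bsize B)
inLeft-range leaf o ()
inLeft-range (node L R) o (inj₁ (refl , lt , lt2)) = lt , lt2 , +-monoʳ-≤ o (s≤s (m≤m+n (bsize L) (bsize R)))
inLeft-range (node L R) o (inj₂ (inj₁ x)) = let (a1 , a2 , a3) = inLeft-range L o x in a1 , a2 , ≤-trans a3 (leftEnd≤ o L R)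
inLeft-range (node L R) o (inj₂ (inj₂ x)) = let (a1 , a2 , a3) = inLeft-range R _ x in
  <-trans (offset<root o (bsize L)) a1 , a2 , ≤-trans a3 (≤-reflexive (rootEnd o L R))

shift-assoc : ∀ s o x y → s + (o + x + y) ≡ s + o + x + y
shift-assoc s o x y = trans (cong (s +_) (+-assoc o x y)) (trans (sym (+-assoc s o (x + y))) (sym (+-assoc (s + o) x y)))

inRight-shift : ∀ B s o {a b} → InRight B o a b → InRight B (s + o) (s + a) (s + b)
inRight-shift leaf s o ()
inRight-shift (node L R) s o {a} {b} (inj₁ (e , lt , le)) =
  inj₁ (trans (cong (s +_) e) (sym (+-assoc s o _)) ,
        subst (_< s + b) (sym (+-assoc s o _)) (+-monoʳ-< s lt) ,
        subst (s + b ≤_) (shift-assoc s o _ _) (+-monoʳ-≤ s le))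
inRight-shift (node L R) s o (inj₂ (inj₁ x)) = inj₂ (inj₁ (inRight-shift L s o x))
inRight-shift (node L R) s o {a} {b} (inj₂ (inj₂ x)) = inj₂ (inj₂ (subst (λ z → InRight R z (s + a) (s + b)) (sym (+-assoc s o _)) (inRight-shift R s _ x)))

inRight-unshift : ∀ B s o {a b} → InRight B (s + o) (s + a) (s + b) → InRight B o a b
inRight-unshift leaf s o ()
inRight-unshift (node L R) s o {a} {b} (inj₁ (e , lt , le)) =
  inj₁ (+-cancelˡ-≡ s _ _ (trans e (+-assoc s o _)) ,
        +-cancelˡ-< s _ _ (subst (_< s + b) (+-assoc s o _) lt) ,
        +-cancelˡ-≤ s _ _ (subst (s + b ≤_) (sym (shift-assoc s o _ _)) le))
inRight-unshift (node L R) s o (inj₂ (inj₁ x)) = inj₂ (inj₁ (inRight-unshift L s o x))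
inRight-unshift (node L R) s o {a} {b} (inj₂ (inj₂ x)) = inj₂ (inj₂ (inRight-unshift R s _ (subst (λ z → InRight R z (s + a) (s + b)) (+-assoc s o _) x)))

inLeft-shift : ∀ B s o {a b} → InLeft B o a b → InLeft B (s + o) (s + a) (s + b)
inLeft-shift leaf s o ()
inLeft-shift (node L R) s o {a} {b} (inj₁ (e , lt , lt2)) =
  inj₁ (trans (cong (s +_) e) (sym (+-assoc s o _)) ,
        +-monoʳ-< s lt ,
        subst (s + a <_) (sym (+-assoc s o _)) (+-monoʳ-< s lt2))
inLeft-shift (node L R) s o (inj₂ (inj₁ x)) = inj₂ (inj₁ (inLeft-shift L s o x))
inLeft-shift (node L R) s o {a} {b} (inj₂ (inj₂ x)) = inj₂ (inj₂ (subst (λ z → InLeft R z (s + a) (s + b)) (sym (+-assoc s o _)) (inLeft-shift R s _ x)))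

inLeft-unshift : ∀ B s o {a b} → InLeft B (s + o) (s + a) (s + b) → InLeft B o a b
inLeft-unshift leaf s o ()
inLeft-unshift (node L R) s o {a} {b} (inj₁ (e , lt , lt2)) =
  inj₁ (+-cancelˡ-≡ s _ _ (trans e (+-assoc s o _)) ,
        +-cancelˡ-< s _ _ lt ,
        +-cancelˡ-< s _ _ (subst (s + a <_) (+-assoc s o _) lt2))
inLeft-unshift (node L R) s o (inj₂ (inj₁ x)) = inj₂ (inj₁ (inLeft-unshift L s o x))
inLeft-unshift (node L R) s o {a} {b} (inj₂ (inj₂ x)) = inj₂ (inj₂ (inLeft-unshift R s _ (subst (λ z → InLeft R z (s + a) (s + b)) (+-assoc s o _) x)))

-- The lower binary tree of a grafting tree

-- graftAt A d B: walk d steps down the left spine of B and insert there a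
-- new node whose left subtree is A and whose right subtree is the part of B
-- hanging from that point (a new root if d exceeds the spine).
graftAt : BT → ℕ → BT → BT
graftAt A zero B = node A B
graftAt A (suc d) leaf = node A leaf
graftAt A (suc d) (node B1 B2) = node (graftAt A d B1) B2

spineSubtreeSize : ℕ → BT → ℕ
spineSubtreeSize zero B = bsize B
spineSubtreeSize (suc d) leaf = 0
spineSubtreeSize (suc d) (node B1 B2) = spineSubtreeSize d B1

bsize-graftAt : ∀ A d B → bsize (graftAt A d B) ≡ suc (bsize A + bsize B)
bsize-graftAt A zero B = refl
bsize-graftAt A (suc d) leaf = refl
bsize-graftAt A (suc d) (node B1 B2) = cong suc (trans (cong (_+ bsize B2) (bsize-graftAt A d B1))
  (trans (cong suc (+-assoc (bsize A) (bsize B1) (bsize B2))) (sym (+-suc (bsize A) _))))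

graftAt-root : ∀ A d B1 o → o + suc (bsize (graftAt A d B1)) ≡ (o + suc (bsize A)) + suc (bsize B1)
graftAt-root A d B1 o = trans (cong (λ z → o + suc z) (bsize-graftAt A d B1))
  (sym (trans (+-assoc o (suc (bsize A)) (suc (bsize B1))) (cong (λ z → o + suc z) (+-suc (bsize A) (bsize B1)))))

InRightGrafted : BT → ℕ → BT → ℕ → ℕ → ℕ → Set
InRightGrafted A d B o a b = InRight A o a b ⊎ InRight B (o + suc (bsize A)) a b ⊎ ((a ≡ o + suc (bsize A)) × (a < b) × (b ≤ a + spineSubtreeSize d B))

inRight-graftAt→ : ∀ A d B o {a b} → InRight (graftAt A d B) o a b → InRightGrafted A d B o a b
inRight-graftAt→ A zero B o (inj₁ (refl , lt , le)) = inj₂ (inj₂ (refl , lt , le))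
inRight-graftAt→ A zero B o (inj₂ (inj₁ x)) = inj₁ x
inRight-graftAt→ A zero B o (inj₂ (inj₂ x)) = inj₂ (inj₁ x)
inRight-graftAt→ A (suc d) leaf o {a} {b} (inj₁ (refl , lt , le)) = ⊥-elim (<⇒≱ lt (subst (b ≤_) (+-identityʳ _) le))
inRight-graftAt→ A (suc d) leaf o (inj₂ (inj₁ x)) = inj₁ x
inRight-graftAt→ A (suc d) leaf o (inj₂ (inj₂ ()))
inRight-graftAt→ A (suc d) (node B1 B2) o {a} {b} (inj₁ (e , lt , le)) =
  inj₂ (inj₁ (inj₁ (trans e (graftAt-root A d B1 o) , subst (_< b) (graftAt-root A d B1 o) lt , subst (λ z → b ≤ z + bsize B2) (graftAt-root A d B1 o) le)))
inRight-graftAt→ A (suc d) (node B1 B2) o (inj₂ (inj₁ x)) with inRight-graftAt→ A d B1 o x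
... | inj₁ y = inj₁ y
... | inj₂ (inj₁ y) = inj₂ (inj₁ (inj₂ (inj₁ y)))
... | inj₂ (inj₂ c) = inj₂ (inj₂ c)
inRight-graftAt→ A (suc d) (node B1 B2) o {a} {b} (inj₂ (inj₂ x)) =
  inj₂ (inj₁ (inj₂ (inj₂ (subst (λ z → InRight B2 z a b) (graftAt-root A d B1 o) x))))

inRight-graftAt← : ∀ A d B o {a b} → InRightGrafted A d B o a b → InRight (graftAt A d B) o a b
inRight-graftAt← A zero B o (inj₁ x) = inj₂ (inj₁ x)
inRight-graftAt← A zero B o (inj₂ (inj₁ y)) = inj₂ (inj₂ y)
inRight-graftAt← A zero B o (inj₂ (inj₂ (refl , lt , le))) = inj₁ (refl , lt , le)
inRight-graftAt← A (suc d) leaf o (inj₁ x) = inj₂ (inj₁ x)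
inRight-graftAt← A (suc d) leaf o (inj₂ (inj₁ ()))
inRight-graftAt← A (suc d) leaf o {a} {b} (inj₂ (inj₂ (refl , lt , le))) = ⊥-elim (<⇒≱ lt (subst (b ≤_) (+-identityʳ _) le))
inRight-graftAt← A (suc d) (node B1 B2) o (inj₁ x) = inj₂ (inj₁ (inRight-graftAt← A d B1 o (inj₁ x)))
inRight-graftAt← A (suc d) (node B1 B2) o {a} {b} (inj₂ (inj₁ (inj₁ (e , lt , le)))) =
  inj₁ (trans e (sym (graftAt-root A d B1 o)) , subst (_< b) (sym (graftAt-root A d B1 o)) lt , subst (λ z → b ≤ z + bsize B2) (sym (graftAt-root A d B1 o)) le)
inRight-graftAt← A (suc d) (node B1 B2) o (inj₂ (inj₁ (inj₂ (inj₁ y)))) = inj₂ (inj₁ (inRight-graftAt← A d B1 o (inj₂ (inj₁ y))))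
inRight-graftAt← A (suc d) (node B1 B2) o {a} {b} (inj₂ (inj₁ (inj₂ (inj₂ y)))) =
  inj₂ (inj₂ (subst (λ z → InRight B2 z a b) (sym (graftAt-root A d B1 o)) y))
inRight-graftAt← A (suc d) (node B1 B2) o (inj₂ (inj₂ c)) = inj₂ (inj₁ (inRight-graftAt← A d B1 o (inj₂ (inj₂ c))))

-- The lower binary tree of Graft⁻¹(node L k R): the lower tree of L grafted
-- onto the lower tree of R so that exactly k of its spine nodes lie below
-- the new vertex (Graft⁻¹ adds y ⊲ p for the first k decreasing roots y).
lowerTree : LT → BT
lowerTree leaf = leaf
lowerTree (node L k R) = graftAt (lowerTree L) (leftSpine (lowerTree R) ∸ k) (lowerTree R)

bsize-lowerTree : ∀ T → bsize (lowerTree T) ≡ size T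
bsize-lowerTree leaf = refl
bsize-lowerTree (node L k R) = trans (bsize-graftAt (lowerTree L) _ (lowerTree R)) (cong suc (cong₂ _+_ (bsize-lowerTree L) (bsize-lowerTree R)))

leftSpine-graftAt : ∀ A d B → d ≤ leftSpine B → leftSpine (graftAt A d B) ≡ suc (leftSpine A) + d
leftSpine-graftAt A zero B _ = sym (+-identityʳ _)
leftSpine-graftAt A (suc d) (node B1 B2) (s≤s le) = trans (cong suc (leftSpine-graftAt A d B1 le)) (sym (+-suc (suc (leftSpine A)) d))

labels : LT → List ℕ
labels leaf = []
labels (node L k R) = labels L ++ k ∷ labels R

-- The grafting inequality at a node says that k does not exceed the spine of
-- the lower tree of its right subtree, so the graft really happens k steps
-- above the bottom of the spine.
label≤leftSpine : ∀ k R → k + labelSum R ≤ size R → leftSpine (lowerTree R) + labelSum R ≡ size R → k ≤ leftSpine (lowerTree R)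
label≤leftSpine k R le e = +-cancelʳ-≤ (labelSum R) k _ (subst (k + labelSum R ≤_) (sym e) le)

-- contacts(D₁) = N − Σ ℓ:  the spine of the lower tree plus the label sum
-- is the size.
leftSpine-lowerTree : ∀ T → IsGrafting T → leftSpine (lowerTree T) + labelSum T ≡ size T
leftSpine-lowerTree leaf _ = refl
leftSpine-lowerTree (node L k R) (gL , gk , gR) =
  trans (cong (_+ (labelSum L + k + labelSum R)) (leftSpine-graftAt (lowerTree L) u (lowerTree R) (m∸n≤m _ k)))
   (trans (regroup (leftSpine (lowerTree L)) u (labelSum L) k (labelSum R))
     (cong suc (cong₂ _+_ (leftSpine-lowerTree L gL) (trans (cong (_+ labelSum R) (m∸n+n≡m kle)) (leftSpine-lowerTree R gR)))))
  where
  kle : k ≤ leftSpine (lowerTree R)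
  kle = label≤leftSpine k R gk (leftSpine-lowerTree R gR)
  u : ℕ
  u = leftSpine (lowerTree R) ∸ k
  regroup : ∀ a u sl k sr → suc a + u + (sl + k + sr) ≡ suc ((a + sl) + ((u + k) + sr))
  regroup = solve 5 (λ a u sl k sr → (con 1 :+ a) :+ u :+ (sl :+ k :+ sr) := con 1 :+ ((a :+ sl) :+ ((u :+ k) :+ sr))) refl

spines-graftAt : ∀ A d B → map leftSpine (rightSubtrees (graftAt A d B)) ≡ map leftSpine (rightSubtrees A) ++ (leftSpine B ∸ d) ∷ map leftSpine (rightSubtrees B)
spines-graftAt A zero B = map-++ leftSpine (rightSubtrees A) _
spines-graftAt A (suc d) leaf = map-++ leftSpine (rightSubtrees A) _
spines-graftAt A (suc d) (node B1 B2) =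
  trans (map-++ leftSpine (rightSubtrees (graftAt A d B1)) _)
   (trans (cong (_++ _) (spines-graftAt A d B1))
    (trans (++-assoc (map leftSpine (rightSubtrees A)) _ _)
     (cong (λ z → map leftSpine (rightSubtrees A) ++ (leftSpine B1 ∸ d) ∷ z) (sym (map-++ leftSpine (rightSubtrees B1) _)))))

-- contacts_i(D₁) = ℓ(v_i):  the right subtree of the i-th node of the lower
-- tree has a left spine of length ℓ(v_i).
spines-lowerTree : ∀ T → IsGrafting T → map leftSpine (rightSubtrees (lowerTree T)) ≡ labels T
spines-lowerTree leaf _ = refl
spines-lowerTree (node L k R) (gL , gk , gR) =
  trans (spines-graftAt (lowerTree L) (leftSpine (lowerTree R) ∸ k) (lowerTree R))
    (cong₂ _++_ (spines-lowerTree L gL) (cong₂ _∷_ (m∸[m∸n]≡n (label≤leftSpine k R gk (leftSpine-lowerTree R gR))) (spines-lowerTree R gR)))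

-- Positions of the left-spine nodes of B (offset o), bottom-up, i.e. in
-- increasing order.  They are the decreasing roots of an interval-poset
-- whose lower tree is B: exactly the nodes with no right-subtree parent.
spinePositions : BT → ℕ → List ℕ
spinePositions leaf o = []
spinePositions (node L R) o = spinePositions L o ++ [ o + suc (bsize L) ]

lowerSpine : ℕ → BT → ℕ → List ℕ
lowerSpine zero B o = spinePositions B o
lowerSpine (suc d) leaf o = []
lowerSpine (suc d) (node B1 B2) o = lowerSpine d B1 o

spinePositions-range : ∀ B o {y} → y ∈ spinePositions B o → (o < y) × (y ≤ o + bsize B)
spinePositions-range leaf o ()
spinePositions-range (node L R) o i with ∈-++⁻ (spinePositions L o) i
... | inj₁ j = let (a , b) = spinePositions-range L o j in a , ≤-trans b (leftEnd≤ o L R)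
... | inj₂ (here refl) = offset<root o (bsize L) , +-monoʳ-≤ o (s≤s (m≤m+n (bsize L) (bsize R)))

spinePositions-complete : ∀ B o y → o < y → y ≤ o + bsize B → (∀ a → o < a → a < y → ¬ InRight B o a y) → y ∈ spinePositions B o
spinePositions-complete leaf o y lt le h = ⊥-elim (<⇒≱ lt (subst (y ≤_) (+-identityʳ o) le))
spinePositions-complete (node L R) o y lt le h with <-cmp y (o + suc (bsize L))
... | tri< yl _ _ = ∈-++⁺ˡ (spinePositions-complete L o y lt (ltRoot o L yl) (λ a oa ay x → h a oa ay (inj₂ (inj₁ x))))
... | tri≈ _ refl _ = ∈-++⁺ʳ (spinePositions L o) (here refl)
... | tri> _ _ yg = ⊥-elim (h _ (offset<root o (bsize L)) yg (inj₁ (refl , yg , ≤-trans le (≤-reflexive (sym (rootEnd o L R))))))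

spinePositions-noParent : ∀ B o y → y ∈ spinePositions B o → ∀ a → ¬ InRight B o a y
spinePositions-noParent leaf o y () a x
spinePositions-noParent (node L R) o y i a x with ∈-++⁻ (spinePositions L o) i
spinePositions-noParent (node L R) o y i a (inj₁ (_ , lt , _)) | inj₁ j = <⇒≱ lt (<⇒≤ (rootLt o L (proj₂ (spinePositions-range L o j))))
spinePositions-noParent (node L R) o y i a (inj₂ (inj₁ x)) | inj₁ j = spinePositions-noParent L o y j a x
spinePositions-noParent (node L R) o y i a (inj₂ (inj₂ x)) | inj₁ j =
  let (a1 , a2 , _) = inRight-range R _ x in <⇒≱ (<-trans a1 a2) (<⇒≤ (rootLt o L (proj₂ (spinePositions-range L o j))))
spinePositions-noParent (node L R) o y i a (inj₁ (_ , lt , _)) | inj₂ (here refl) = <-irrefl refl lt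
spinePositions-noParent (node L R) o y i a (inj₂ (inj₁ x)) | inj₂ (here refl) = <⇒≱ (rootLt o L ≤-refl) (proj₂ (proj₂ (inRight-range L o x)))
spinePositions-noParent (node L R) o y i a (inj₂ (inj₂ x)) | inj₂ (here refl) = let (a1 , a2 , _) = inRight-range R _ x in <-asym a1 a2

linked-spinePositions : ∀ B o → Linked _<_ (spinePositions B o)
linked-spinePositions leaf o = []
linked-spinePositions (node L R) o = linked-snoc (spinePositions L o) (linked-spinePositions L o) (λ z i → rootLt o L (proj₂ (spinePositions-range L o i)))

length-spinePositions : ∀ B o → length (spinePositions B o) ≡ leftSpine B
length-spinePositions leaf o = refl
length-spinePositions (node L R) o = trans (length-++ (spinePositions L o)) (trans (+-comm _ 1) (cong suc (length-spinePositions L o)))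

lowerSpine-take : ∀ d B o → d ≤ leftSpine B → take (leftSpine B ∸ d) (spinePositions B o) ≡ lowerSpine d B o
lowerSpine-take zero B o _ = take-all (leftSpine B) (spinePositions B o) (≤-reflexive (length-spinePositions B o))
lowerSpine-take (suc d) (node B1 B2) o (s≤s le) =
  trans (take-++ˡ (leftSpine B1 ∸ d) (spinePositions B1 o) _ (subst (leftSpine B1 ∸ d ≤_) (sym (length-spinePositions B1 o)) (m∸n≤m _ d)))
        (lowerSpine-take d B1 o le)

lowerSpine⊆ : ∀ d B o {y} → y ∈ lowerSpine d B o → y ∈ spinePositions B o
lowerSpine⊆ zero B o i = i
lowerSpine⊆ (suc d) leaf o ()
lowerSpine⊆ (suc d) (node B1 B2) o i = ∈-++⁺ˡ (lowerSpine⊆ d B1 o i)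

lowerSpine-subtreeEnd : ∀ d B o {y y'} → y ∈ lowerSpine d B o → (y' ≡ y ⊎ InRight B o y y') → y' ≤ o + spineSubtreeSize d B
lowerSpine-subtreeEnd zero B o i (inj₁ refl) = proj₂ (spinePositions-range B o i)
lowerSpine-subtreeEnd zero B o i (inj₂ x) = proj₂ (proj₂ (inRight-range B o x))
lowerSpine-subtreeEnd (suc d) leaf o () _
lowerSpine-subtreeEnd (suc d) (node B1 B2) o i (inj₁ e) = lowerSpine-subtreeEnd d B1 o i (inj₁ e)
lowerSpine-subtreeEnd (suc d) (node B1 B2) o i (inj₂ (inj₁ (refl , _))) =
  ⊥-elim (<-irrefl refl (rootLt o B1 (proj₂ (spinePositions-range B1 o (lowerSpine⊆ d B1 o i)))))
lowerSpine-subtreeEnd (suc d) (node B1 B2) o i (inj₂ (inj₂ (inj₁ x))) = lowerSpine-subtreeEnd d B1 o i (inj₂ x)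
lowerSpine-subtreeEnd (suc d) (node B1 B2) o i (inj₂ (inj₂ (inj₂ x))) =
  ⊥-elim (<⇒≱ (proj₁ (inRight-range B2 _ x)) (<⇒≤ (rootLt o B1 (proj₂ (spinePositions-range B1 o (lowerSpine⊆ d B1 o i))))))

spine-covers : ∀ B o {y'} → o < y' → y' ≤ o + bsize B → Σ ℕ λ y → y ∈ spinePositions B o × (y' ≡ y ⊎ InRight B o y y')
spine-covers leaf o {y'} lt le = ⊥-elim (<⇒≱ lt (subst (y' ≤_) (+-identityʳ o) le))
spine-covers (node L R) o {y'} lt le with <-cmp y' (o + suc (bsize L))
... | tri< yl _ _ = let (y , i , r) = spine-covers L o lt (ltRoot o L yl) in
  y , ∈-++⁺ˡ i , lift r
  where
  lift : ∀ {y} → y' ≡ y ⊎ InRight L o y y' → y' ≡ y ⊎ InRight (node L R) o y y'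
  lift (inj₁ e) = inj₁ e
  lift (inj₂ x) = inj₂ (inj₂ (inj₁ x))
... | tri≈ _ refl _ = _ , ∈-++⁺ʳ (spinePositions L o) (here refl) , inj₁ refl
... | tri> _ _ yg = _ , ∈-++⁺ʳ (spinePositions L o) (here refl) , inj₂ (inj₁ (refl , yg , ≤-trans le (≤-reflexive (sym (rootEnd o L R)))))

lowerSpine-covers : ∀ d B o {y'} → o < y' → y' ≤ o + spineSubtreeSize d B → Σ ℕ λ y → y ∈ lowerSpine d B o × (y' ≡ y ⊎ InRight B o y y')
lowerSpine-covers zero B o lt le = spine-covers B o lt le
lowerSpine-covers (suc d) leaf o {y'} lt le = ⊥-elim (<⇒≱ lt (subst (y' ≤_) (+-identityʳ o) le))
lowerSpine-covers (suc d) (node B1 B2) o lt le with lowerSpine-covers d B1 o lt le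
... | y , i , inj₁ e = y , i , inj₁ e
... | y , i , inj₂ x = y , i , inj₂ (inj₂ (inj₁ x))

firstDRoot-isDRoot : ∀ {R n r y} → FirstDRoots R n r y → DRoot R n y
firstDRoot-isDRoot {r = r} (ys , _ , mem , i) = proj₁ (mem _) (Any-resp-⊆ (take-⊆ r ys) i)

GraftStep : LT → ℕ → LT → Relℕ
GraftStep L k R a b =
    graftInv L a b
  ⊎ Shift (suc (size L)) (graftInv R) a b
  ⊎ ((b ≡ suc (size L)) × (1 ≤ a) × (a ≤ size L))
  ⊎ ((b ≡ suc (size L)) × Σ ℕ λ y → (a ≡ suc (size L) + y) × FirstDRoots (graftInv R) (size R) k y)

InRange : LT → ℕ → Set
InRange S a = (1 ≤ a) × (a ≤ size S)

graftInv-trans : ∀ S {a b c} → graftInv S a b → graftInv S b c → graftInv S a c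
graftInv-trans leaf () _
graftInv-trans (node L k R) x y = x ◅◅ y

graftInv-refl : ∀ S {a} → 1 ≤ a → a ≤ size S → graftInv S a a
graftInv-refl leaf (s≤s _) ()
graftInv-refl (node L k R) _ _ = ε

mutual
  graftInv-range : ∀ S {a b} → graftInv S a b → a ≡ b ⊎ (InRange S a × InRange S b)
  graftInv-range leaf ()
  graftInv-range (node L k R) r = star-range L k R r

  star-range : ∀ L k R {a b} → Star (GraftStep L k R) a b → a ≡ b ⊎ (InRange (node L k R) a × InRange (node L k R) b)
  star-range L k R ε = inj₁ refl
  star-range L k R (s ◅ r) with step-range L k R s | star-range L k R r
  ... | inj₁ refl | q = q
  ... | inj₂ (ia , ib) | inj₁ refl = inj₂ (ia , ib)
  ... | inj₂ (ia , ib) | inj₂ (_ , ic) = inj₂ (ia , ic)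

  step-range : ∀ L k R {a b} → GraftStep L k R a b → a ≡ b ⊎ (InRange (node L k R) a × InRange (node L k R) b)
  step-range L k R (inj₁ g) with graftInv-range L g
  ... | inj₁ e = inj₁ e
  ... | inj₂ ((a1 , a2) , (b1 , b2)) = inj₂ ((a1 , ≤-trans a2 L≤) , (b1 , ≤-trans b2 L≤))
    where
    L≤ : size L ≤ suc (size L + size R)
    L≤ = ≤-trans (m≤m+n (size L) (size R)) (n≤1+n _)
  step-range L k R (inj₂ (inj₁ (a' , b' , refl , refl , g))) with graftInv-range R g
  ... | inj₁ refl = inj₁ refl
  ... | inj₂ ((a1 , a2) , (b1 , b2)) =
    inj₂ ((≤-trans a1 (m≤n+m a' _) , s≤s (+-monoʳ-≤ (size L) a2)) , (≤-trans b1 (m≤n+m b' _) , s≤s (+-monoʳ-≤ (size L) b2)))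
  step-range L k R (inj₂ (inj₂ (inj₁ (refl , a1 , a2)))) =
    inj₂ ((a1 , ≤-trans a2 (≤-trans (m≤m+n (size L) (size R)) (n≤1+n _))) , (s≤s z≤n , s≤s (m≤m+n _ _)))
  step-range L k R (inj₂ (inj₂ (inj₂ (refl , y , refl , fr)))) with firstDRoot-isDRoot fr
  ... | (y1 , y2 , _) = inj₂ ((≤-trans y1 (m≤n+m y _) , s≤s (+-monoʳ-≤ (size L) y2)) , (s≤s z≤n , s≤s (m≤m+n _ _)))

-- Normal form of Graft⁻¹(node L k R), with p = |L| + 1 the new vertex: a
-- relation is either trivial, inside I_L, inside the shifted I_R, from I_L
-- to p, or from a shifted y' to p through a first-k decreasing root y of I_R.
-- No longer chains are needed, since p is maximal and I_L, I_R are disjoint.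
module GraftOrder (L : LT) (k : ℕ) (R : LT) where
  p : ℕ
  p = suc (size L)

  NormalForm : Relℕ
  NormalForm x z =
      (x ≡ z) ⊎ graftInv L x z ⊎ Shift p (graftInv R) x z ⊎ ((z ≡ p) × (1 ≤ x) × (x ≤ size L))
    ⊎ ((z ≡ p) × Σ ℕ λ y' → Σ ℕ λ y → (x ≡ p + y') × FirstDRoots (graftInv R) (size R) k y × graftInv R y' y)

  notInLeft : ∀ y → InRange L (p + y) → ⊥
  notInLeft y (_ , le) = 1+n≰n (≤-trans (s≤s (m≤m+n (size L) y)) le)

  fromRoot-left : ∀ {z} → graftInv L p z → z ≡ p
  fromRoot-left g with graftInv-range L g
  ... | inj₁ e = sym e
  ... | inj₂ ((_ , le) , _) = ⊥-elim (1+n≰n le)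

  fromRoot-right : ∀ {y z} → p ≡ p + y → graftInv R y z → p + z ≡ p
  fromRoot-right {y} e g with +-cancelˡ-≡ p 0 y (trans (+-identityʳ p) e)
  ... | refl with graftInv-range R g
  ... | inj₁ refl = +-identityʳ p
  ... | inj₂ ((() , _) , _)

  leftToRoot : ∀ {x z} → z ≡ p → 1 ≤ x → x ≤ size L → NormalForm x z
  leftToRoot e a b = inj₂ (inj₂ (inj₂ (inj₁ (e , a , b))))

  rightToRoot : ∀ {x z} → z ≡ p → ∀ y' y → x ≡ p + y' → FirstDRoots (graftInv R) (size R) k y →
                graftInv R y' y → NormalForm x z
  rightToRoot e y' y ex fr g = inj₂ (inj₂ (inj₂ (inj₂ (e , y' , y , ex , fr , g))))

  prepend-left : ∀ {x y z} → graftInv L x y → NormalForm y z → NormalForm x z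
  prepend-left g (inj₁ refl) = inj₂ (inj₁ g)
  prepend-left g (inj₂ (inj₁ g₂)) = inj₂ (inj₁ (graftInv-trans L g g₂))
  prepend-left g (inj₂ (inj₂ (inj₁ (y₁ , z₁ , refl , refl , g₂)))) with graftInv-range L g
  ... | inj₁ refl = inj₂ (inj₂ (inj₁ (y₁ , z₁ , refl , refl , g₂)))
  ... | inj₂ (_ , iy) = ⊥-elim (notInLeft y₁ iy)
  prepend-left g (inj₂ (inj₂ (inj₂ (inj₁ (refl , y₁ , y₂))))) with graftInv-range L g
  ... | inj₁ refl = leftToRoot refl y₁ y₂
  ... | inj₂ ((x₁ , x₂) , _) = leftToRoot refl x₁ x₂
  prepend-left g (inj₂ (inj₂ (inj₂ (inj₂ (refl , y' , y₀ , refl , fr , g₂))))) with graftInv-range L g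
  ... | inj₁ refl = rightToRoot refl y' y₀ refl fr g₂
  ... | inj₂ (_ , iy) = ⊥-elim (notInLeft y' iy)

  prepend-right : ∀ {x y z} → Shift p (graftInv R) x y → NormalForm y z → NormalForm x z
  prepend-right s (inj₁ refl) = inj₂ (inj₂ (inj₁ s))
  prepend-right s@(x₁ , y₁ , refl , refl , g) (inj₂ (inj₁ g₂)) with graftInv-range L g₂
  ... | inj₁ refl = inj₂ (inj₂ (inj₁ s))
  ... | inj₂ (iy , _) = ⊥-elim (notInLeft y₁ iy)
  prepend-right (x₁ , y₁ , refl , refl , g) (inj₂ (inj₂ (inj₁ (y₂ , z₂ , e , refl , g₂))))
    with +-cancelˡ-≡ p y₁ y₂ e
  ... | refl = inj₂ (inj₂ (inj₁ (x₁ , z₂ , refl , refl , graftInv-trans R g g₂)))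
  prepend-right (x₁ , y₁ , refl , refl , g) (inj₂ (inj₂ (inj₂ (inj₁ (refl , a₁ , a₂))))) =
    ⊥-elim (notInLeft y₁ (a₁ , a₂))
  prepend-right (x₁ , y₁ , refl , refl , g) (inj₂ (inj₂ (inj₂ (inj₂ (refl , y' , y₀ , e , fr , g₂)))))
    with +-cancelˡ-≡ p y₁ y' e
  ... | refl = rightToRoot refl x₁ y₀ refl fr (graftInv-trans R g g₂)

  atRoot : ∀ {z} → NormalForm p z → z ≡ p
  atRoot (inj₁ refl) = refl
  atRoot (inj₂ (inj₁ g)) = fromRoot-left g
  atRoot (inj₂ (inj₂ (inj₁ (y , z , e , refl , g)))) = fromRoot-right e g
  atRoot (inj₂ (inj₂ (inj₂ (inj₁ (e , _))))) = e
  atRoot (inj₂ (inj₂ (inj₂ (inj₂ (e , _))))) = e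

  prepend-step : ∀ {x y z} → GraftStep L k R x y → NormalForm y z → NormalForm x z
  prepend-step (inj₁ g) nf = prepend-left g nf
  prepend-step (inj₂ (inj₁ s)) nf = prepend-right s nf
  prepend-step (inj₂ (inj₂ (inj₁ (refl , x₁ , x₂)))) nf = leftToRoot (atRoot nf) x₁ x₂
  prepend-step (inj₂ (inj₂ (inj₂ (refl , y₀ , refl , fr)))) nf with firstDRoot-isDRoot fr
  ... | (d₁ , d₂ , _) = rightToRoot (atRoot nf) y₀ y₀ refl fr (graftInv-refl R d₁ d₂)

  normalise : ∀ {x z} → graftInv (node L k R) x z → NormalForm x z
  normalise ε = inj₁ refl
  normalise (s ◅ r) = prepend-step s (normalise r)

  realise : ∀ {x z} → NormalForm x z → graftInv (node L k R) x z
  realise (inj₁ refl) = ε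
  realise (inj₂ (inj₁ g)) = inj₁ g ◅ ε
  realise (inj₂ (inj₂ (inj₁ sh))) = inj₂ (inj₁ sh) ◅ ε
  realise (inj₂ (inj₂ (inj₂ (inj₁ c)))) = inj₂ (inj₂ (inj₁ c)) ◅ ε
  realise (inj₂ (inj₂ (inj₂ (inj₂ (e , y' , y , ex , fr , g))))) =
    inj₂ (inj₁ (y' , y , ex , refl , g)) ◅ (inj₂ (inj₂ (inj₂ (e , y , refl , fr))) ◅ ε)

-- The lower and upper trees of Graft⁻¹(T)

-- For an interval-poset with lower tree B, the decreasing roots are the spine
-- positions of B; the elements weakly below one of the first k of them
-- (k ≤ spine) are exactly the positions of the part of B hanging
-- (spine − k) steps down its spine.
module DecreasingRoots (Rel : Relℕ) (N : ℕ) (B : BT) (il : IsLower Rel N B) (k : ℕ) (kle : k ≤ leftSpine B) where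
  d : ℕ
  d = leftSpine B ∸ k

  bN : bsize B ≡ N
  bN = proj₁ il

  dRoot⇒spine : ∀ {y} → DRoot Rel N y → y ∈ spinePositions B 0
  dRoot⇒spine {y} (y1 , yN , h) = spinePositions-complete B 0 y y1 (subst (y ≤_) (sym bN) yN)
    (λ a oa ay x → h a oa ay (proj₂ (proj₂ il a y oa ay yN) x))

  spine⇒dRoot : ∀ {y} → y ∈ spinePositions B 0 → DRoot Rel N y
  spine⇒dRoot {y} i = let (y1 , y2) = spinePositions-range B 0 i in
    y1 , subst (y ≤_) bN y2 , λ a a1 ay r → spinePositions-noParent B 0 y i a (proj₁ (proj₂ il a y a1 ay (subst (y ≤_) bN y2)) r)

  firstRoots-lowerSpine : take k (spinePositions B 0) ≡ lowerSpine d B 0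
  firstRoots-lowerSpine = trans (cong (λ z → take z (spinePositions B 0)) (sym (m∸[m∸n]≡n kle)))
                                (lowerSpine-take d B 0 (m∸n≤m _ k))

  belowFirstRoots⇒lowerPart : ∀ {y y'} → FirstDRoots Rel N k y → 1 ≤ y' → y' ≤ N → (y' ≡ y ⊎ Rel y' y) → y' ≤ spineSubtreeSize d B
  belowFirstRoots⇒lowerPart {y} {y'} (ys , lk , mem , i) y1' yN' r = go r
    where
    eq : ys ≡ spinePositions B 0
    eq = sorted-unique ys (spinePositions B 0) lk (linked-spinePositions B 0) (λ z j → dRoot⇒spine (proj₁ (mem z) j)) (λ z j → proj₂ (mem z) (spine⇒dRoot j))
    iy : y ∈ lowerSpine d B 0
    iy = subst (y ∈_) firstRoots-lowerSpine (subst (λ z → y ∈ take k z) eq i)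
    y1 : 1 ≤ y
    y1 = proj₁ (spinePositions-range B 0 (lowerSpine⊆ d B 0 iy))
    go : (y' ≡ y ⊎ Rel y' y) → y' ≤ spineSubtreeSize d B
    go (inj₁ e) = lowerSpine-subtreeEnd d B 0 iy (inj₁ e)
    go (inj₂ x) with <-cmp y' y
    ... | tri< lt _ _ = ≤-trans (<⇒≤ lt) (lowerSpine-subtreeEnd d B 0 iy (inj₁ refl))
    ... | tri≈ _ e _ = lowerSpine-subtreeEnd d B 0 iy (inj₁ e)
    ... | tri> _ _ gt = lowerSpine-subtreeEnd d B 0 iy (inj₂ (proj₁ (proj₂ il y y' y1 gt yN') x))

  lowerPart⇒belowFirstRoots : ∀ {y'} → 1 ≤ y' → y' ≤ spineSubtreeSize d B → Σ ℕ λ y → FirstDRoots Rel N k y × (y' ≡ y ⊎ Rel y' y)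
  lowerPart⇒belowFirstRoots {y'} y1' le with lowerSpine-covers d B 0 y1' le
  ... | y , iy , r = y , (spinePositions B 0 , linked-spinePositions B 0 , (λ z → spine⇒dRoot , dRoot⇒spine) , subst (y ∈_) (sym firstRoots-lowerSpine) iy) , conv r
    where
    conv : y' ≡ y ⊎ InRight B 0 y y' → y' ≡ y ⊎ Rel y' y
    conv (inj₁ e) = inj₁ e
    conv (inj₂ x) = let (a1 , a2 , a3) = inRight-range B 0 x in inj₂ (proj₂ (proj₂ il y y' a1 a2 (subst (y' ≤_) bN a3)) x)

splitAbove : ∀ p {a} → p < a → Σ ℕ λ a1 → (a ≡ p + a1) × (1 ≤ a1)
splitAbove p {a} lt = a ∸ p , sym (m+[n∸m]≡n (<⇒≤ lt)) , +-cancelˡ-< p 0 (a ∸ p) (subst₂ _<_ (sym (+-identityʳ p)) (sym (m+[n∸m]≡n (<⇒≤ lt))) lt)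

empty-range : ∀ {a b} → a < b → b ≤ 0 → ⊥
empty-range ab b0 with ≤-trans ab b0
... | ()

module NodeTrees (L : LT) (k : ℕ) (R : LT) (gk : k + labelSum R ≤ size R) (gR : IsGrafting R)
                 (ILL : IsLower (graftInv L) (size L) (lowerTree L)) (IUL : IsUpper (graftInv L) (size L) (shape L))
                 (ILR : IsLower (graftInv R) (size R) (lowerTree R)) (IUR : IsUpper (graftInv R) (size R) (shape R)) where
  open GraftOrder L k R
  A : BT
  A = lowerTree L
  B : BT
  B = lowerTree R
  N : ℕ
  N = suc (size L + size R)
  open DecreasingRoots (graftInv R) (size R) B ILR k (label≤leftSpine k R gk (leftSpine-lowerTree R gR))
  qA : suc (bsize A) ≡ p
  qA = cong suc (bsize-lowerTree L)
  qS : suc (bsize (shape L)) ≡ p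
  qS = cong suc (bsize-shape L)

  -- b ⊲ a in Graft⁻¹(node L k R) iff v_b is in the right subtree of v_a in
  -- the grafted lower tree: relations inside L and R are those of A and B,
  -- and the new vertex p is above exactly the lower part of B.
  lower→ : ∀ {a b} → 1 ≤ a → a < b → b ≤ N → NormalForm b a → InRight (graftAt A d B) 0 a b
  lower→ a1 ab bN (inj₁ refl) = ⊥-elim (<-irrefl refl ab)
  lower→ {a} {b} a1 ab bN (inj₂ (inj₁ g)) with graftInv-range L g
  ... | inj₁ refl = ⊥-elim (<-irrefl refl ab)
  ... | inj₂ ((_ , b2) , _) = inRight-graftAt← A d B 0 (inj₁ (proj₁ (proj₂ ILL a b a1 ab b2) g))
  lower→ a1 ab bN (inj₂ (inj₂ (inj₁ (b1 , a1' , refl , refl , g)))) with graftInv-range R g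
  ... | inj₁ refl = ⊥-elim (<-irrefl refl ab)
  ... | inj₂ ((_ , b1R) , (a1'1 , _)) =
    inRight-graftAt← A d B 0 (inj₂ (inj₁ (subst (λ z → InRight B z (p + a1') (p + b1)) (trans (+-identityʳ p) (sym qA))
      (inRight-shift B p 0 (proj₁ (proj₂ ILR a1' b1 a1'1 (+-cancelˡ-< p a1' b1 ab) b1R) g)))))
  lower→ a1 ab bN (inj₂ (inj₂ (inj₂ (inj₁ (refl , b1 , b2))))) = ⊥-elim (<-asym ab (s≤s b2))
  lower→ a1 ab bN (inj₂ (inj₂ (inj₂ (inj₂ (refl , y' , y , refl , fr , g))))) =
    inRight-graftAt← A d B 0 (inj₂ (inj₂ (sym qA , ab , +-monoʳ-≤ p le)))
    where
    y'1 : 1 ≤ y'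
    y'1 = +-cancelˡ-< p 0 y' (subst (_< p + y') (sym (+-identityʳ p)) ab)
    le : y' ≤ spineSubtreeSize d B
    le = belowFirstRoots⇒lowerPart fr y'1 (+-cancelˡ-≤ p y' (size R) bN) (inj₂ g)

  lower← : ∀ {a b} → 1 ≤ a → a < b → b ≤ N → InRightGrafted A d B 0 a b → NormalForm b a
  lower← {a} {b} a1 ab bN (inj₁ x) =
    inj₂ (inj₁ (proj₂ (proj₂ ILL a b a1 ab (subst (b ≤_) (bsize-lowerTree L) (proj₂ (proj₂ (inRight-range A 0 x))))) x))
  lower← {a} {b} a1 ab bN (inj₂ (inj₁ x)) with inRight-range B p (subst (λ z → InRight B z a b) qA x)
  ... | pa , _ , bE with splitAbove p pa | splitAbove p (<-trans pa ab)
  ... | a1' , refl , a1'1 | b1 , refl , _ =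
    inj₂ (inj₂ (inj₁ (b1 , a1' , refl , refl ,
      proj₂ (proj₂ ILR a1' b1 a1'1 (+-cancelˡ-< p a1' b1 ab) (subst (b1 ≤_) (bsize-lowerTree R) (+-cancelˡ-≤ p b1 _ bE)))
        (inRight-unshift B p 0 (subst (λ z → InRight B z (p + a1') (p + b1)) (trans qA (sym (+-identityʳ p))) x)))))
  lower← {a} {b} a1 ab bN (inj₂ (inj₂ (ea , ab' , le))) with trans ea qA
  ... | refl with splitAbove p ab
  ... | y' , refl , y'1 with lowerPart⇒belowFirstRoots y'1 (+-cancelˡ-≤ p y' _ le)
  ... | y , fr , r = inj₂ (inj₂ (inj₂ (inj₂ (refl , y' , y , refl , fr , g r))))
    where
    g : y' ≡ y ⊎ graftInv R y' y → graftInv R y' y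
    g (inj₁ refl) = let (d1 , d2 , _) = firstDRoot-isDRoot fr in graftInv-refl R d1 d2
    g (inj₂ x) = x

  lower : IsLower (graftInv (node L k R)) N (graftAt A d B)
  lower = trans (bsize-graftAt A d B) (cong suc (cong₂ _+_ (bsize-lowerTree L) (bsize-lowerTree R))) ,
    λ a b a1 ab bN → (λ r → lower→ a1 ab bN (normalise r)) , (λ x → realise (lower← a1 ab bN (inRight-graftAt→ A d B 0 x)))

  -- a ⊲ b iff v_a is in the left subtree of v_b in node (shape L) (shape R):
  -- besides the relations inside L and R, only the elements of L lie below p.
  upper→ : ∀ {a b} → 1 ≤ a → a < b → b ≤ N → NormalForm a b → InLeft (node (shape L) (shape R)) 0 a b
  upper→ a1 ab bN (inj₁ refl) = ⊥-elim (<-irrefl refl ab)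
  upper→ {a} {b} a1 ab bN (inj₂ (inj₁ g)) with graftInv-range L g
  ... | inj₁ refl = ⊥-elim (<-irrefl refl ab)
  ... | inj₂ (_ , (_ , b2)) = inj₂ (inj₁ (proj₁ (proj₂ IUL a b a1 ab b2) g))
  upper→ a1 ab bN (inj₂ (inj₂ (inj₁ (a1' , b1 , refl , refl , g)))) with graftInv-range R g
  ... | inj₁ refl = ⊥-elim (<-irrefl refl ab)
  ... | inj₂ ((a1'1 , _) , (_ , b1R)) =
    inj₂ (inj₂ (subst (λ z → InLeft (shape R) z (p + a1') (p + b1)) (trans (+-identityʳ p) (sym qS))
      (inLeft-shift (shape R) p 0 (proj₁ (proj₂ IUR a1' b1 a1'1 (+-cancelˡ-< p a1' b1 ab) b1R) g))))
  upper→ {a} a1 ab bN (inj₂ (inj₂ (inj₂ (inj₁ (refl , a1x , aL))))) = inj₁ (sym qS , a1 , subst (a <_) (sym qS) (s≤s aL))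
  upper→ a1 ab bN (inj₂ (inj₂ (inj₂ (inj₂ (refl , y' , y , refl , fr , g))))) = ⊥-elim (<⇒≱ ab (m≤m+n p y'))

  upper← : ∀ {a b} → 1 ≤ a → a < b → b ≤ N → InLeft (node (shape L) (shape R)) 0 a b → NormalForm a b
  upper← {a} a1 ab bN (inj₁ (eb , _ , aq)) = inj₂ (inj₂ (inj₂ (inj₁ (trans eb qS , a1 , ≤-pred (subst (a <_) qS aq)))))
  upper← {a} {b} a1 ab bN (inj₂ (inj₁ x)) =
    inj₂ (inj₁ (proj₂ (proj₂ IUL a b a1 ab (subst (b ≤_) (bsize-shape L) (proj₂ (proj₂ (inLeft-range (shape L) 0 x))))) x))
  upper← {a} {b} a1 ab bN (inj₂ (inj₂ x)) with inLeft-range (shape R) p (subst (λ z → InLeft (shape R) z a b) qS x)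
  ... | pa , _ , bE with splitAbove p pa | splitAbove p (<-trans pa ab)
  ... | a1' , refl , a1'1 | b1 , refl , _ =
    inj₂ (inj₂ (inj₁ (a1' , b1 , refl , refl ,
      proj₂ (proj₂ IUR a1' b1 a1'1 (+-cancelˡ-< p a1' b1 ab) (subst (b1 ≤_) (bsize-shape R) (+-cancelˡ-≤ p b1 _ bE)))
        (inLeft-unshift (shape R) p 0 (subst (λ z → InLeft (shape R) z (p + a1') (p + b1)) (trans qS (sym (+-identityʳ p))) x)))))

  upper : IsUpper (graftInv (node L k R)) N (node (shape L) (shape R))
  upper = cong suc (cong₂ _+_ (bsize-shape L) (bsize-shape R)) ,
    λ a b a1 ab bN → (λ r → upper→ a1 ab bN (normalise r)) , (λ x → realise (upper← a1 ab bN x))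

lowerUpperTrees : ∀ T → IsGrafting T → IsLower (graftInv T) (size T) (lowerTree T) × IsUpper (graftInv T) (size T) (shape T)
lowerUpperTrees leaf _ = (refl , λ a b a1 ab b0 → ⊥-elim (empty-range ab b0)) , (refl , λ a b a1 ab b0 → ⊥-elim (empty-range ab b0))
lowerUpperTrees (node L k R) (gL , gk , gR) = NodeTrees.lower L k R gk gR ILL IUL ILR IUR , NodeTrees.upper L k R gk gR ILL IUL ILR IUR
  where
  ILL : IsLower (graftInv L) (size L) (lowerTree L)
  ILL = proj₁ (lowerUpperTrees L gL)
  IUL : IsUpper (graftInv L) (size L) (shape L)
  IUL = proj₂ (lowerUpperTrees L gL)
  ILR : IsLower (graftInv R) (size R) (lowerTree R)
  ILR = proj₁ (lowerUpperTrees R gR)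
  IUR : IsUpper (graftInv R) (size R) (shape R)
  IUR = proj₂ (lowerUpperTrees R gR)

-- Uniqueness of the lower and upper trees

InRight⊆ : BT → BT → ℕ → Set
InRight⊆ T T' o = ∀ a b → o < a → a < b → b ≤ o + bsize T → InRight T o a b → InRight T' o a b

InLeft⊆ : BT → BT → ℕ → Set
InLeft⊆ T T' o = ∀ a b → o < a → a < b → b ≤ o + bsize T → InLeft T o a b → InLeft T' o a b

noIntoRoot : ∀ L R o {a} → InRight (node L R) o a (o + suc (bsize L)) → ⊥
noIntoRoot L R o (inj₁ (_ , lt , _)) = <-irrefl refl lt
noIntoRoot L R o (inj₂ (inj₁ x)) = <⇒≱ (rootLt o L ≤-refl) (proj₂ (proj₂ (inRight-range L o x)))
noIntoRoot L R o (inj₂ (inj₂ x)) = let (a1 , a2 , _) = inRight-range R _ x in <-asym a1 a2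

noFromRoot : ∀ L R o {b} → InLeft (node L R) o (o + suc (bsize L)) b → ⊥
noFromRoot L R o (inj₁ (_ , _ , lt)) = <-irrefl refl lt
noFromRoot L R o (inj₂ (inj₁ x)) = let (_ , a2 , a3) = inLeft-range L o x in <⇒≱ (<-trans (rootLt o L a3) a2) ≤-refl
noFromRoot L R o (inj₂ (inj₂ x)) = <-irrefl refl (proj₁ (inLeft-range R _ x))

-- Two trees of equal size with mutually contained relations have their roots
-- at the same position: otherwise the later root lies in the right subtree
-- (resp. the earlier one in the left subtree) of the other one.
rootsAgreeR : ∀ L R L' R' o → bsize (node L R) ≡ bsize (node L' R') →
              InRight⊆ (node L R) (node L' R') o → InRight⊆ (node L' R') (node L R) o → bsize L ≡ bsize L'
rootsAgreeR L R L' R' o e h h' with <-cmp (bsize L) (bsize L')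
... | tri≈ _ eq _ = eq
... | tri< lt _ _ = ⊥-elim (noIntoRoot L' R' o (h _ _ (offset<root o (bsize L)) pp' p'≤ (inj₁ (refl , pp' , ≤-trans p'≤ (≤-reflexive (sym (rootEnd o L R)))))))
  where
  pp' : o + suc (bsize L) < o + suc (bsize L')
  pp' = +-monoʳ-< o (s≤s lt)
  p'≤ : o + suc (bsize L') ≤ o + bsize (node L R)
  p'≤ = subst (λ z → o + suc (bsize L') ≤ o + z) (sym e) (+-monoʳ-≤ o (s≤s (m≤m+n (bsize L') (bsize R'))))
... | tri> _ _ gt = ⊥-elim (noIntoRoot L R o (h' _ _ (offset<root o (bsize L')) p'p p≤ (inj₁ (refl , p'p , ≤-trans p≤ (≤-reflexive (sym (rootEnd o L' R')))))))
  where
  p'p : o + suc (bsize L') < o + suc (bsize L)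
  p'p = +-monoʳ-< o (s≤s gt)
  p≤ : o + suc (bsize L) ≤ o + bsize (node L' R')
  p≤ = subst (λ z → o + suc (bsize L) ≤ o + z) e (+-monoʳ-≤ o (s≤s (m≤m+n (bsize L) (bsize R))))

rootsAgreeL : ∀ L R L' R' o → InLeft⊆ (node L R) (node L' R') o → InLeft⊆ (node L' R') (node L R) o → bsize L ≡ bsize L'
rootsAgreeL L R L' R' o h h' with <-cmp (bsize L) (bsize L')
... | tri≈ _ eq _ = eq
... | tri< lt _ _ = ⊥-elim (noFromRoot L R o (h' _ _ (offset<root o (bsize L)) pp' p'≤ (inj₁ (refl , offset<root o (bsize L) , pp'))))
  where
  pp' : o + suc (bsize L) < o + suc (bsize L')
  pp' = +-monoʳ-< o (s≤s lt)
  p'≤ : o + suc (bsize L') ≤ o + bsize (node L' R')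
  p'≤ = +-monoʳ-≤ o (s≤s (m≤m+n (bsize L') (bsize R')))
... | tri> _ _ gt = ⊥-elim (noFromRoot L' R' o (h _ _ (offset<root o (bsize L')) p'p p≤ (inj₁ (refl , offset<root o (bsize L') , p'p))))
  where
  p'p : o + suc (bsize L') < o + suc (bsize L)
  p'p = +-monoʳ-< o (s≤s gt)
  p≤ : o + suc (bsize L) ≤ o + bsize (node L R)
  p≤ = +-monoʳ-≤ o (s≤s (m≤m+n (bsize L) (bsize R)))

InRight⊆-left : ∀ L R L' R' o → bsize L ≡ bsize L' → InRight⊆ (node L R) (node L' R') o → InRight⊆ L L' o
InRight⊆-left L R L' R' o eL h a b oa ab le x with h a b oa ab (≤-trans le (leftEnd≤ o L R)) (inj₂ (inj₁ x))
... | inj₁ (_ , lt , _) = ⊥-elim (<⇒≱ lt (<⇒≤ (rootLt o L' (subst (λ z → b ≤ o + z) eL le))))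
... | inj₂ (inj₁ x') = x'
... | inj₂ (inj₂ x') = let (a1 , a2 , _) = inRight-range R' _ x' in
  ⊥-elim (<⇒≱ (<-trans a1 a2) (<⇒≤ (rootLt o L' (subst (λ z → b ≤ o + z) eL le))))

InRight⊆-right : ∀ L R L' R' o → bsize L ≡ bsize L' → InRight⊆ (node L R) (node L' R') o →
                 InRight⊆ R R' (o + suc (bsize L))
InRight⊆-right L R L' R' o eL h a b qa ab le x
  with h a b (<-trans (offset<root o (bsize L)) qa) ab (≤-trans le (≤-reflexive (rootEnd o L R))) (inj₂ (inj₂ x))
... | inj₁ (refl , _ , _) = ⊥-elim (<-irrefl (cong (λ z → o + suc z) eL) qa)
... | inj₂ (inj₁ x') = let (_ , a2 , a3) = inRight-range L' o x' in
  ⊥-elim (<-asym qa (subst (λ z → a < o + suc z) (sym eL) (<-trans a2 (rootLt o L' a3))))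
... | inj₂ (inj₂ x') = subst (λ z → InRight R' (o + suc z) a b) (sym eL) x'

InLeft⊆-left : ∀ L R L' R' o → bsize L ≡ bsize L' → InLeft⊆ (node L R) (node L' R') o → InLeft⊆ L L' o
InLeft⊆-left L R L' R' o eL h a b oa ab le x with h a b oa ab (≤-trans le (leftEnd≤ o L R)) (inj₂ (inj₁ x))
... | inj₁ (refl , _ , _) = ⊥-elim (<-irrefl refl (rootLt o L' (subst (λ z → b ≤ o + z) eL le)))
... | inj₂ (inj₁ x') = x'
... | inj₂ (inj₂ x') = let (a1 , a2 , _) = inLeft-range R' _ x' in
  ⊥-elim (<⇒≱ (<-trans a1 a2) (<⇒≤ (rootLt o L' (subst (λ z → b ≤ o + z) eL le))))

InLeft⊆-right : ∀ L R L' R' o → bsize L ≡ bsize L' → InLeft⊆ (node L R) (node L' R') o →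
                InLeft⊆ R R' (o + suc (bsize L))
InLeft⊆-right L R L' R' o eL h a b qa ab le x
  with h a b (<-trans (offset<root o (bsize L)) qa) ab (≤-trans le (≤-reflexive (rootEnd o L R))) (inj₂ (inj₂ x))
... | inj₁ (_ , _ , ap) = ⊥-elim (<-asym qa (subst (λ z → a < o + suc z) (sym eL) ap))
... | inj₂ (inj₁ x') = let (_ , a2 , a3) = inLeft-range L' o x' in
  ⊥-elim (<-asym qa (subst (λ z → a < o + suc z) (sym eL) (<-trans a2 (rootLt o L' a3))))
... | inj₂ (inj₂ x') = subst (λ z → InLeft R' (o + suc z) a b) (sym eL) x'

rightSizes : ∀ L R L' R' → bsize (node L R) ≡ bsize (node L' R') → bsize L ≡ bsize L' → bsize R ≡ bsize R'
rightSizes L R L' R' e eL = +-cancelˡ-≡ (bsize L) _ _ (trans (suc-injective e) (cong (_+ bsize R') (sym eL)))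

uniqueByInRight : ∀ T T' o → bsize T ≡ bsize T' → InRight⊆ T T' o → InRight⊆ T' T o → T ≡ T'
uniqueByInRight leaf leaf o _ _ _ = refl
uniqueByInRight leaf (node _ _) o () _ _
uniqueByInRight (node _ _) leaf o () _ _
uniqueByInRight (node L R) (node L' R') o e h h' =
  cong₂ node (uniqueByInRight L L' o eL (InRight⊆-left L R L' R' o eL h) (InRight⊆-left L' R' L R o (sym eL) h'))
             (uniqueByInRight R R' (o + suc (bsize L)) (rightSizes L R L' R' e eL) (InRight⊆-right L R L' R' o eL h)
                (subst (λ z → InRight⊆ R' R (o + suc z)) (sym eL) (InRight⊆-right L' R' L R o (sym eL) h')))
  where
  eL : bsize L ≡ bsize L'
  eL = rootsAgreeR L R L' R' o e h h'

uniqueByInLeft : ∀ T T' o → bsize T ≡ bsize T' → InLeft⊆ T T' o → InLeft⊆ T' T o → T ≡ T'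
uniqueByInLeft leaf leaf o _ _ _ = refl
uniqueByInLeft leaf (node _ _) o () _ _
uniqueByInLeft (node _ _) leaf o () _ _
uniqueByInLeft (node L R) (node L' R') o e h h' =
  cong₂ node (uniqueByInLeft L L' o eL (InLeft⊆-left L R L' R' o eL h) (InLeft⊆-left L' R' L R o (sym eL) h'))
             (uniqueByInLeft R R' (o + suc (bsize L)) (rightSizes L R L' R' e eL) (InLeft⊆-right L R L' R' o eL h)
                (subst (λ z → InLeft⊆ R' R (o + suc z)) (sym eL) (InLeft⊆-right L' R' L R o (sym eL) h')))
  where
  eL : bsize L ≡ bsize L'
  eL = rootsAgreeL L R L' R' o h h'

uniqueLower : ∀ {Rel N T T'} → IsLower Rel N T → IsLower Rel N T' → T ≡ T'
uniqueLower {T = T} {T'} (e , h) (e' , h') =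
  uniqueByInRight T T' 0 (trans e (sym e'))
    (λ a b oa ab le x → proj₁ (h' a b oa ab (subst (b ≤_) e le)) (proj₂ (h a b oa ab (subst (b ≤_) e le)) x))
    (λ a b oa ab le x → proj₁ (h a b oa ab (subst (b ≤_) e' le)) (proj₂ (h' a b oa ab (subst (b ≤_) e' le)) x))

uniqueUpper : ∀ {Rel N T T'} → IsUpper Rel N T → IsUpper Rel N T' → T ≡ T'
uniqueUpper {T = T} {T'} (e , h) (e' , h') =
  uniqueByInLeft T T' 0 (trans e (sym e'))
    (λ a b oa ab le x → proj₁ (h' a b oa ab (subst (b ≤_) e le)) (proj₂ (h a b oa ab (subst (b ≤_) e le)) x))
    (λ a b oa ab le x → proj₁ (h a b oa ab (subst (b ≤_) e' le)) (proj₂ (h' a b oa ab (subst (b ≤_) e' le)) x))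

contacts-lowerTree : ∀ T → IsGrafting T → contacts (enc (lowerTree T)) + labelSum T ≡ size T
contacts-lowerTree T g = trans (cong (_+ labelSum T) (contacts-enc (lowerTree T))) (leftSpine-lowerTree T g)

contactsI-lowerTree : ∀ T → IsGrafting T → ∀ k → k < size T → contactsI (enc (lowerTree T)) k ≡ nth 0 (labels T) k
contactsI-lowerTree T g k lt = begin
    contactsI (enc (lowerTree T)) k
      ≡⟨ contactsI-enc (lowerTree T) k (subst (k <_) (sym (bsize-lowerTree T)) lt) ⟩
    leftSpine (nth leaf (rightSubtrees (lowerTree T)) k)  ≡⟨ nth-map leftSpine leaf (rightSubtrees (lowerTree T)) k ⟩
    nth 0 (map leftSpine (rightSubtrees (lowerTree T))) k  ≡⟨ cong (λ z → nth 0 z k) (spines-lowerTree T g) ⟩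
    nth 0 (labels T) k  ∎
  where open ≡-Reasoning

length-labels : ∀ T → length (labels T) ≡ size T
length-labels leaf = refl
length-labels (node L k R) =
  trans (length-++ (labels L)) (trans (cong₂ (λ a b → a + suc b) (length-labels L) (length-labels R)) (+-suc (size L) (size R)))

-- The last node of a grafting tree has an empty right subtree, so label 0;
-- this is why the contact vector need not mention it.
lastLabel-zero : ∀ T j → IsGrafting T → size T ≡ suc j → nth 0 (labels T) j ≡ 0
lastLabel-zero (node L k leaf) j (_ , k≤0 , _) e = begin
    nth 0 (labels L ++ k ∷ []) j                     ≡⟨ cong (nth 0 (labels L ++ k ∷ [])) j≡ ⟩
    nth 0 (labels L ++ k ∷ []) (length (labels L) + 0)  ≡⟨ nth-++ʳ 0 (labels L) (k ∷ []) 0 ⟩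
    k                                                ≡⟨ n≤0⇒n≡0 (subst (_≤ 0) (+-identityʳ k) k≤0) ⟩
    0  ∎
  where
  open ≡-Reasoning
  j≡ : j ≡ length (labels L) + 0
  j≡ = trans (sym (suc-injective e)) (cong (_+ 0) (sym (length-labels L)))
lastLabel-zero (node L k R@(node RL k₂ RR)) j (_ , _ , gR) e = begin
    nth 0 (labels L ++ k ∷ labels R) j                                  ≡⟨ cong (nth 0 (labels L ++ k ∷ labels R)) j≡ ⟩
    nth 0 (labels L ++ k ∷ labels R) (length (labels L) + suc (size RL + size RR))
      ≡⟨ nth-++ʳ 0 (labels L) (k ∷ labels R) (suc (size RL + size RR)) ⟩
    nth 0 (labels R) (size RL + size RR)                                ≡⟨ lastLabel-zero R (size RL + size RR) gR refl ⟩
    0  ∎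
  where
  open ≡-Reasoning
  j≡ : j ≡ length (labels L) + suc (size RL + size RR)
  j≡ = trans (sym (suc-injective e)) (cong (_+ size R) (sym (length-labels L)))

module ContactCondition (m : ℕ) where

  LabelsDivisible : LT → Set
  LabelsDivisible leaf = ⊤
  LabelsDivisible (node L k R) = LabelsDivisible L × (m ∣ k) × LabelsDivisible R

  labelsDivisible⇒All : ∀ T → LabelsDivisible T → All (m ∣_) (labels T)
  labelsDivisible⇒All leaf _ = []
  labelsDivisible⇒All (node L k R) (dL , dk , dR) = ++⁺ (labelsDivisible⇒All L dL) (dk ∷ labelsDivisible⇒All R dR)

  All⇒labelsDivisible : ∀ T → All (m ∣_) (labels T) → LabelsDivisible T
  All⇒labelsDivisible leaf _ = tt
  All⇒labelsDivisible (node L k R) a with ++⁻ (labels L) a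
  ... | aL , (dk ∷ aR) = All⇒labelsDivisible L aL , dk , All⇒labelsDivisible R aR

  All⇒nth : ∀ {xs} → All (m ∣_) xs → ∀ k → m ∣ nth 0 xs k
  All⇒nth [] k = m ∣0
  All⇒nth (d ∷ a) zero = d
  All⇒nth (d ∷ a) (suc k) = All⇒nth a k

  nth⇒All : ∀ xs → (∀ k → k < length xs → m ∣ nth 0 xs k) → All (m ∣_) xs
  nth⇒All [] h = []
  nth⇒All (x ∷ xs) h = h zero (s≤s z≤n) ∷ nth⇒All xs (λ k lt → h (suc k) (s≤s lt))

  labelSum-divisible : ∀ T → LabelsDivisible T → m ∣ labelSum T
  labelSum-divisible leaf _ = m ∣0
  labelSum-divisible (node L k R) (dL , dk , dR) = ∣m∣n⇒∣m+n (∣m∣n⇒∣m+n (labelSum-divisible L dL) dk) (labelSum-divisible R dR)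

-- Rise-contact-m-divisibility of Graft⁻¹(T)

module Characterisation (m : ℕ) where
  open RiseCondition m
  open ContactCondition m

  divisible⇒riseContactDiv : ∀ T N → IsGrafting T → size T ≡ N → m ∣ N →
                             LabelsDivisible T → EndsDivisible 0 T → RiseContactDiv m N (graftInv T)
  divisible⇒riseContactDiv T N g refl m∣N labelsDiv endsDiv =
    lowerTree T , shape T , proj₁ (lowerUpperTrees T g) , proj₂ (lowerUpperTrees T g) ,
    contacts-div , contactsI-div , proj₁ runs , (λ k _ → proj₂ runs k)
    where
    contacts-div : m ∣ contacts (enc (lowerTree T))
    contacts-div = ∣m+n∣m⇒∣n (subst (m ∣_) (sym (trans (+-comm (labelSum T) _) (contacts-lowerTree T g))) m∣N)
                             (labelSum-divisible T labelsDiv)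
    contactsI-div : ∀ k → suc k < size T → m ∣ contactsI (enc (lowerTree T)) k
    contactsI-div k lt = subst (m ∣_) (sym (contactsI-lowerTree T g k (<-trans (n<1+n k) lt)))
                               (All⇒nth (labelsDivisible⇒All T labelsDiv) k)
    runs : (m ∣ 0 + leadingUps (enc (shape T))) × (∀ k → m ∣ leadingUps (afterDown k (enc (shape T))))
    runs = rises-divisible 0 (enc (shape T)) (ends⇒downs 0 T endsDiv) (subst (m ∣_) (sym (ups-enc-shape T)) m∣N)

  riseContactDiv⇒divisible : ∀ T N → IsGrafting T → size T ≡ N → RiseContactDiv m N (graftInv T) →
                             LabelsDivisible T × EndsDivisible 0 T
  riseContactDiv⇒divisible T N g refl (T₁ , T₂ , isLower , isUpper , _ , contactsI-div , rise₀ , risesI-div) =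
    All⇒labelsDivisible T (nth⇒All (labels T) labelDiv) ,
    downs⇒ends 0 T (downsAtMultiples-of-rises 0 (enc (shape T)) (subst (λ B → m ∣ rises (enc B)) T₂≡ rise₀) laterRises)
    where
    T₁≡ : T₁ ≡ lowerTree T
    T₁≡ = uniqueLower isLower (proj₁ (lowerUpperTrees T g))
    T₂≡ : T₂ ≡ shape T
    T₂≡ = uniqueUpper isUpper (proj₂ (lowerUpperTrees T g))
    labelDiv : ∀ k → k < length (labels T) → m ∣ nth 0 (labels T) k
    labelDiv k lt with suc k <? size T
    ... | yes k+1<N = subst (m ∣_) (contactsI-lowerTree T g k (<-trans (n<1+n k) k+1<N))
                                   (subst (λ B → m ∣ contactsI (enc B) k) T₁≡ (contactsI-div k k+1<N))
    ... | no k+1≮N = subst (m ∣_) (sym (lastLabel-zero T k g size≡)) (m ∣0)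
      where
      size≡ : size T ≡ suc k
      size≡ = ≤-antisym (≮⇒≥ k+1≮N) (subst (suc k ≤_) (length-labels T) lt)
    laterRises : ∀ k → suc k < downs (enc (shape T)) → m ∣ leadingUps (afterDown k (enc (shape T)))
    laterRises k lt = subst (λ B → m ∣ risesI (enc B) k) T₂≡
                            (risesI-div k (subst (suc k <_) (trans (downs-enc (shape T)) (bsize-shape T)) lt))

-- Arithmetic of expand and contract

module ExpandContract (m : ℕ) .{{_ : NonZero m}} where
  open RiseCondition m using (EndsDivisible)
  open ContactCondition m using (LabelsDivisible)

  nonMultiple : ℕ → ℕ
  nonMultiple p = if does (m ∣? p) then 0 else 1

  nonMultiplesAfter : ℕ → ℕ → ℕ
  nonMultiplesAfter a zero = 0
  nonMultiplesAfter a (suc l) = nonMultiple (suc a) + nonMultiplesAfter (suc a) l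

  nonMultiplesAfter-+ : ∀ a x y → nonMultiplesAfter a (x + y) ≡ nonMultiplesAfter a x + nonMultiplesAfter (a + x) y
  nonMultiplesAfter-+ a zero y = cong (λ z → nonMultiplesAfter z y) (sym (+-identityʳ a))
  nonMultiplesAfter-+ a (suc x) y =
    trans (cong (nonMultiple (suc a) +_)
                (trans (nonMultiplesAfter-+ (suc a) x y) (cong (λ z → nonMultiplesAfter (suc a) x + nonMultiplesAfter z y) (sym (+-suc a x)))))
          (sym (+-assoc (nonMultiple (suc a)) _ _))

  m*suc : ∀ μ → m * suc μ ≡ m * μ + m
  m*suc μ = trans (*-suc m μ) (+-comm m (m * μ))

  nextMultiple : ∀ {s μ} → m ∣ suc s → m * μ ≤ s → s < m * μ + m → suc s ≡ m * suc μ
  nextMultiple {s} {μ} (divides q eq) lo hi = trans eq' (cong (m *_) q≡)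
    where
    eq' : suc s ≡ m * q
    eq' = trans eq (*-comm q m)
    q≡ : q ≡ suc μ
    q≡ = ≤-antisym (*-cancelˡ-≤ m (subst₂ _≤_ eq' (sym (m*suc μ)) hi))
                   (*-cancelˡ-< m μ q (subst (m * μ <_) eq' (s≤s lo)))

  -- Counting window: if p + s is a multiple of m, then among p, …, p + s the
  -- non-multiples number s − μ, where μ = ⌊s/m⌋ (i.e. m μ ≤ s < m μ + m).
  window : ∀ p s → m ∣ p + s →
           Σ ℕ λ μ → (nonMultiple p + nonMultiplesAfter p s + μ ≡ s) × (m * μ ≤ s) × (s < m * μ + m)
  window p zero d with m ∣? p
  ... | yes _ = 0 , refl , ≤-reflexive (*-zeroʳ m) , subst (0 <_) (cong (_+ m) (sym (*-zeroʳ m))) (>-nonZero⁻¹ m)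
  ... | no m∤p = ⊥-elim (m∤p (subst (m ∣_) (+-identityʳ p) d))
  window p (suc s) d with window (suc p) s (subst (m ∣_) (+-suc p s) d)
  ... | μ , count , lo , hi with m ∣? p
  ... | yes m∣p = suc μ , trans (+-suc _ μ) (cong suc count) , ≤-reflexive (sym s+1≡) ,
                  subst (_< m * suc μ + m) (sym s+1≡) (m<m+n (m * suc μ) (>-nonZero⁻¹ m))
    where
    s+1≡ : suc s ≡ m * suc μ
    s+1≡ = nextMultiple (∣m+n∣m⇒∣n d m∣p) lo hi
  ... | no m∤p = μ , cong suc count , m≤n⇒m≤1+n lo , ≤∧≢⇒< hi notNext
    where
    notNext : suc s ≢ m * μ + m
    notNext eq = m∤p (∣m+n∣m⇒∣n (subst (m ∣_) (+-comm p (suc s)) d)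
                                (subst (m ∣_) (sym (trans eq (sym (m*suc μ)))) (m∣m*n (suc μ))))

  nonMultipleNodes : ℕ → LT → ℕ
  nonMultipleNodes o leaf = 0
  nonMultipleNodes o (node L k R) =
    nonMultipleNodes o L + nonMultiple (o + suc (size L)) + nonMultipleNodes (o + suc (size L)) R

  nonMultipleNodes≡ : ∀ o S → nonMultipleNodes o S ≡ nonMultiplesAfter o (size S)
  nonMultipleNodes≡ o leaf = refl
  nonMultipleNodes≡ o (node L k R) = begin
      nonMultipleNodes o L + nonMultiple (o + suc (size L)) + nonMultipleNodes (o + suc (size L)) R
    ≡⟨ cong₂ (λ x y → x + nonMultiple (o + suc (size L)) + y) (nonMultipleNodes≡ o L) (nonMultipleNodes≡ _ R) ⟩
      nonMultiplesAfter o (size L) + nonMultiple (o + suc (size L)) + nonMultiplesAfter (o + suc (size L)) (size R)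
    ≡⟨ cong (λ z → nonMultiplesAfter o (size L) + nonMultiple z + nonMultiplesAfter z (size R)) (+-suc o (size L)) ⟩
      nonMultiplesAfter o (size L) + nonMultiple (suc (o + size L)) + nonMultiplesAfter (suc (o + size L)) (size R)
    ≡⟨ +-assoc (nonMultiplesAfter o (size L)) _ _ ⟩
      nonMultiplesAfter o (size L) + nonMultiplesAfter (o + size L) (suc (size R))
    ≡⟨ sym (nonMultiplesAfter-+ o (size L) (suc (size R))) ⟩
      nonMultiplesAfter o (size L + suc (size R))
    ≡⟨ cong (nonMultiplesAfter o) (+-suc (size L) (size R)) ⟩
      nonMultiplesAfter o (suc (size L + size R)) ∎
    where open ≡-Reasoning

  -- In an m-labelled grafting tree every subtree ends at a multiple of m:
  -- the last node of a subtree has an empty right subtree, hence label 0,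
  -- which m-labelling only allows at multiples of m.
  subtreeEnd-divisible : ∀ o L k R → IsGrafting (node L k R) → MLabels m o (node L k R) → m ∣ (o + suc (size L)) + size R
  subtreeEnd-divisible o L k leaf (_ , k≤0 , _) (_ , positive , _) with m ∣? (o + suc (size L))
  ... | yes d = subst (m ∣_) (sym (+-identityʳ _)) d
  ... | no m∤ with positive m∤ | k≤0
  ... | s≤s _ | ()
  subtreeEnd-divisible o L k (node RL k₂ RR) (_ , _ , gR) (_ , _ , mR) =
    subst (m ∣_) (+-assoc (o + suc (size L)) (suc (size RL)) (size RR)) (subtreeEnd-divisible (o + suc (size L)) RL k₂ RR gR mR)

  mLabels⇒endsDivisible : ∀ o S → IsGrafting S → MLabels m o S → EndsDivisible o S
  mLabels⇒endsDivisible o leaf _ _ = tt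
  mLabels⇒endsDivisible o (node L k R) g@(gL , _ , gR) ml@(mL , _ , mR) =
    mLabels⇒endsDivisible o L gL mL , subtreeEnd-divisible o L k R g ml , mLabels⇒endsDivisible _ R gR mR

  size-expand : ∀ o S → size (expandFrom m o S) ≡ size S
  size-expand o leaf = refl
  size-expand o (node L k R) = cong suc (cong₂ _+_ (size-expand o L) (size-expand _ R))

  size-contract : ∀ o S → size (contractFrom m o S) ≡ size S
  size-contract o leaf = refl
  size-contract o (node L k R) = cong suc (cong₂ _+_ (size-contract o L) (size-contract _ R))

  regroup : ∀ a b c x y z → (a + b + c) + m * (x + y + z) ≡ (a + m * x) + (b + m * y) + (c + m * z)
  regroup = solve 7 (λ M a b c x y z → (a :+ b :+ c) :+ M :* (x :+ y :+ z) := (a :+ M :* x) :+ (b :+ M :* y) :+ (c :+ M :* z)) refl m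

  m*-distrib₃ : ∀ a b c → m * (a + b + c) ≡ m * a + m * b + m * c
  m*-distrib₃ a b c = trans (*-distribˡ-+ m (a + b) c) (cong (_+ m * c) (*-distribˡ-+ m a b))

  expandLabel : ∀ p k → (¬ (m ∣ p) → 1 ≤ k) →
                (if does (m ∣? p) then m * k else m * (k ∸ 1)) + m * nonMultiple p ≡ m * k
  expandLabel p k positive with m ∣? p
  ... | yes _ = trans (cong (m * k +_) (*-zeroʳ m)) (+-identityʳ _)
  ... | no m∤ with positive m∤
  ... | s≤s {n = k'} _ = trans (cong (m * k' +_) (*-identityʳ m)) (sym (m*suc k'))

  labelSum-expand : ∀ o S → MLabels m o S → labelSum (expandFrom m o S) + m * nonMultipleNodes o S ≡ m * labelSum S
  labelSum-expand o leaf _ = refl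
  labelSum-expand o (node L k R) (mL , mk , mR) = begin
      (eL + k' + eR) + m * (nL + np + nR)      ≡⟨ regroup eL k' eR nL np nR ⟩
      (eL + m * nL) + (k' + m * np) + (eR + m * nR)
        ≡⟨ cong₃ (λ a b c → a + b + c) (labelSum-expand o L mL) (expandLabel p k mk) (labelSum-expand p R mR) ⟩
      m * labelSum L + m * k + m * labelSum R  ≡⟨ sym (m*-distrib₃ (labelSum L) k (labelSum R)) ⟩
      m * labelSum (node L k R)  ∎
    where
    open ≡-Reasoning
    p : ℕ
    p = o + suc (size L)
    k' : ℕ
    k' = if does (m ∣? p) then m * k else m * (k ∸ 1)
    eL : ℕ
    eL = labelSum (expandFrom m o L)
    eR : ℕ
    eR = labelSum (expandFrom m p R)
    nL : ℕ
    nL = nonMultipleNodes o L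
    np : ℕ
    np = nonMultiple p
    nR : ℕ
    nR = nonMultipleNodes p R

  contractLabel : ∀ p k → m ∣ k → m * (if does (m ∣? p) then k / m else suc (k / m)) ≡ k + m * nonMultiple p
  contractLabel p k d with m ∣? p
  ... | yes _ = trans (m*[n/m]≡n d) (sym (trans (cong (k +_) (*-zeroʳ m)) (+-identityʳ k)))
  ... | no _ = trans (m*suc (k / m)) (cong₂ _+_ (m*[n/m]≡n d) (sym (*-identityʳ m)))

  labelSum-contract : ∀ o S → LabelsDivisible S → m * labelSum (contractFrom m o S) ≡ labelSum S + m * nonMultipleNodes o S
  labelSum-contract o leaf _ = refl
  labelSum-contract o (node L k R) (dL , dk , dR) = begin
      m * (cL + c + cR)                        ≡⟨ m*-distrib₃ cL c cR ⟩
      m * cL + m * c + m * cR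
        ≡⟨ cong₃ (λ a b c → a + b + c) (labelSum-contract o L dL) (contractLabel p k dk) (labelSum-contract p R dR) ⟩
      (labelSum L + m * nL) + (k + m * np) + (labelSum R + m * nR)
        ≡⟨ sym (regroup (labelSum L) k (labelSum R) nL np nR) ⟩
      labelSum (node L k R) + m * (nL + np + nR)  ∎
    where
    open ≡-Reasoning
    p : ℕ
    p = o + suc (size L)
    c : ℕ
    c = if does (m ∣? p) then k / m else suc (k / m)
    cL : ℕ
    cL = labelSum (contractFrom m o L)
    cR : ℕ
    cR = labelSum (contractFrom m p R)
    nL : ℕ
    nL = nonMultipleNodes o L
    np : ℕ
    np = nonMultiple p
    nR : ℕ
    nR = nonMultipleNodes p R

  expand-bound : ∀ Y Z μ X s → Y + m * Z ≡ m * X → X ≤ s → Z + μ ≡ s → m * μ ≤ s → Y ≤ s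
  expand-bound Y Z μ X s e₁ X≤s e₂ mμ≤s = ≤-trans (+-cancelˡ-≤ (m * Z) Y (m * μ) h) mμ≤s
    where
    h : m * Z + Y ≤ m * Z + m * μ
    h = subst₂ _≤_ (trans (sym e₁) (+-comm Y (m * Z)))
          (trans (cong (m *_) (sym e₂)) (*-distribˡ-+ m Z μ)) (*-monoʳ-≤ m X≤s)

  contract-bound : ∀ C Z μ X s → m * C ≡ X + m * Z → X ≤ s → Z + μ ≡ s → s < m * μ + m → C ≤ s
  contract-bound C Z μ X s e₁ X≤s e₂ s<mμ+m = subst (C ≤_) e₂ (≤-pred (*-cancelˡ-< m C (suc (Z + μ)) h))
    where
    h : m * C < m * suc (Z + μ)
    h = subst₂ _<_ (sym e₁)
          (solve 3 (λ M Z μ → (M :* μ :+ M) :+ M :* Z := M :* (con 1 :+ (Z :+ μ))) refl m Z μ)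
          (+-monoˡ-< (m * Z) (≤-<-trans X≤s s<mμ+m))

  regroup₂ : ∀ a b x y → (a + b) + m * (x + y) ≡ (a + m * x) + (b + m * y)
  regroup₂ = solve 5 (λ M a b x y → (a :+ b) :+ M :* (x :+ y) := (a :+ M :* x) :+ (b :+ M :* y)) refl m

  module AtNode (p k : ℕ) (R : LT) (ends : m ∣ p + size R) where
    μ : ℕ
    μ = proj₁ (window p (size R) ends)

    nonMultiples+μ : (nonMultiple p + nonMultipleNodes p R) + μ ≡ size R
    nonMultiples+μ = trans (cong (λ z → nonMultiple p + z + μ) (nonMultipleNodes≡ p R)) (proj₁ (proj₂ (window p (size R) ends)))

    mμ≤ : m * μ ≤ size R
    mμ≤ = proj₁ (proj₂ (proj₂ (window p (size R) ends)))

    <mμ+m : size R < m * μ + m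
    <mμ+m = proj₂ (proj₂ (proj₂ (window p (size R) ends)))

  expand-isGrafting : ∀ o S → IsGrafting S → MLabels m o S → EndsDivisible o S → IsGrafting (expandFrom m o S)
  expand-isGrafting o leaf _ _ _ = tt
  expand-isGrafting o (node L k R) (gL , gk , gR) (mL , mk , mR) (eL , ek , eR) =
    expand-isGrafting o L gL mL eL , subst (k' + labelSum (expandFrom m p R) ≤_) (sym (size-expand p R)) bound ,
    expand-isGrafting p R gR mR eR
    where
    p : ℕ
    p = o + suc (size L)
    k' : ℕ
    k' = if does (m ∣? p) then m * k else m * (k ∸ 1)
    open AtNode p k R ek
    sums : (k' + labelSum (expandFrom m p R)) + m * (nonMultiple p + nonMultipleNodes p R) ≡ m * (k + labelSum R)
    sums = trans (regroup₂ k' _ (nonMultiple p) (nonMultipleNodes p R))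
                 (trans (cong₂ _+_ (expandLabel p k mk) (labelSum-expand p R mR)) (sym (*-distribˡ-+ m k (labelSum R))))
    bound : k' + labelSum (expandFrom m p R) ≤ size R
    bound = expand-bound _ _ μ (k + labelSum R) (size R) sums gk nonMultiples+μ mμ≤

  contract-isGrafting : ∀ o S → IsGrafting S → LabelsDivisible S → EndsDivisible o S → IsGrafting (contractFrom m o S)
  contract-isGrafting o leaf _ _ _ = tt
  contract-isGrafting o (node L k R) (gL , gk , gR) (dL , dk , dR) (eL , ek , eR) =
    contract-isGrafting o L gL dL eL , subst (c + labelSum (contractFrom m p R) ≤_) (sym (size-contract p R)) bound ,
    contract-isGrafting p R gR dR eR
    where
    p : ℕ
    p = o + suc (size L)
    c : ℕ
    c = if does (m ∣? p) then k / m else suc (k / m)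
    open AtNode p k R ek
    sums : m * (c + labelSum (contractFrom m p R)) ≡ (k + labelSum R) + m * (nonMultiple p + nonMultipleNodes p R)
    sums = trans (*-distribˡ-+ m c _)
                 (trans (cong₂ _+_ (contractLabel p k dk) (labelSum-contract p R dR))
                        (sym (regroup₂ k (labelSum R) (nonMultiple p) (nonMultipleNodes p R))))
    bound : c + labelSum (contractFrom m p R) ≤ size R
    bound = contract-bound _ _ μ (k + labelSum R) (size R) sums gk nonMultiples+μ <mμ+m

  contract-mLabels : ∀ o S → MLabels m o (contractFrom m o S)
  contract-mLabels o leaf = tt
  contract-mLabels o (node L k R) rewrite size-contract o L =
    contract-mLabels o L , positive , contract-mLabels (o + suc (size L)) R
    where
    positive : ¬ (m ∣ (o + suc (size L))) → 1 ≤ (if does (m ∣? (o + suc (size L))) then k / m else suc (k / m))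
    positive m∤ with m ∣? (o + suc (size L))
    ... | yes m∣ = ⊥-elim (m∤ m∣)
    ... | no _ = s≤s z≤n

  expand-labelsDivisible : ∀ o S → LabelsDivisible (expandFrom m o S)
  expand-labelsDivisible o leaf = tt
  expand-labelsDivisible o (node L k R) = expand-labelsDivisible o L , divisible , expand-labelsDivisible _ R
    where
    divisible : m ∣ (if does (m ∣? (o + suc (size L))) then m * k else m * (k ∸ 1))
    divisible with m ∣? (o + suc (size L))
    ... | yes _ = m∣m*n k
    ... | no _ = m∣m*n (k ∸ 1)

  expand-endsDivisible : ∀ o S → EndsDivisible o S → EndsDivisible o (expandFrom m o S)
  expand-endsDivisible o leaf _ = tt
  expand-endsDivisible o (node L k R) (eL , d , eR) rewrite size-expand o L =
    expand-endsDivisible o L eL , subst (λ z → m ∣ (o + suc (size L)) + z) (sym (size-expand _ R)) d ,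
    expand-endsDivisible _ R eR

  contract-expand : ∀ o S → MLabels m o S → contractFrom m o (expandFrom m o S) ≡ S
  contract-expand o leaf _ = refl
  contract-expand o (node L k R) (mL , mk , mR) rewrite size-expand o L =
    cong₃ node (contract-expand o L mL) label (contract-expand _ R mR)
    where
    label : (if does (m ∣? (o + suc (size L))) then (if does (m ∣? (o + suc (size L))) then m * k else m * (k ∸ 1)) / m
             else suc ((if does (m ∣? (o + suc (size L))) then m * k else m * (k ∸ 1)) / m)) ≡ k
    label with m ∣? (o + suc (size L))
    ... | yes _ = trans (cong (_/ m) (*-comm m k)) (m*n/n≡m k m)
    ... | no m∤ with mk m∤
    ... | s≤s {n = k'} _ = cong suc (trans (cong (_/ m) (*-comm m k')) (m*n/n≡m k' m))

  expand-contract : ∀ o S → LabelsDivisible S → expandFrom m o (contractFrom m o S) ≡ S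
  expand-contract o leaf _ = refl
  expand-contract o (node L k R) (dL , dk , dR) rewrite size-contract o L =
    cong₃ node (expand-contract o L dL) label (expand-contract _ R dR)
    where
    label : (if does (m ∣? (o + suc (size L))) then m * (if does (m ∣? (o + suc (size L))) then k / m else suc (k / m))
             else m * ((if does (m ∣? (o + suc (size L))) then k / m else suc (k / m)) ∸ 1)) ≡ k
    label with m ∣? (o + suc (size L))
    ... | yes _ = m*[n/m]≡n dk
    ... | no _ = m*[n/m]≡n dk

  nonMultipleNodes-total : ∀ n T → size T ≡ n * m → nonMultipleNodes 0 T + n ≡ n * m
  nonMultipleNodes-total n T sz with window 0 (size T) (subst (m ∣_) (sym sz) (n∣m*n n))
  ... | μ , count , lo , hi = begin
      nonMultipleNodes 0 T + n                          ≡⟨ cong₂ _+_ (nonMultipleNodes≡ 0 T) (sym μ≡n) ⟩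
      nonMultiplesAfter 0 (size T) + μ                  ≡⟨ cong (λ z → z + nonMultiplesAfter 0 (size T) + μ) (sym nonMultiple0) ⟩
      nonMultiple 0 + nonMultiplesAfter 0 (size T) + μ  ≡⟨ count ⟩
      size T                                            ≡⟨ sz ⟩
      n * m  ∎
    where
    open ≡-Reasoning
    nonMultiple0 : nonMultiple 0 ≡ 0
    nonMultiple0 with m ∣? 0
    ... | yes _ = refl
    ... | no m∤0 = ⊥-elim (m∤0 (m ∣0))
    mn≡ : size T ≡ m * n
    mn≡ = trans sz (*-comm n m)
    μ≡n : μ ≡ n
    μ≡n = ≤-antisym (*-cancelˡ-≤ m (subst (m * μ ≤_) mn≡ lo))
                    (≤-pred (*-cancelˡ-< m n (suc μ) (subst₂ _<_ mn≡ (sym (m*suc μ)) hi)))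

  contacts-scale : ∀ n c S c' S' nm → c + S ≡ n * m → S' + m * nm ≡ m * S → nm + n ≡ n * m → c' + S' ≡ n * m →
                   c' ≡ m * c
  contacts-scale n c S c' S' nm e₁ e₂ e₃ e₄ = +-cancelʳ-≡ S' c' (m * c) (trans e₄ (sym mc+S'≡N))
    where
    open ≡-Reasoning
    shifted : m * nm + (m * c + S') ≡ m * nm + n * m
    shifted = begin
      m * nm + (m * c + S')  ≡⟨ trans (+-comm (m * nm) _) (+-assoc (m * c) S' (m * nm)) ⟩
      m * c + (S' + m * nm)  ≡⟨ cong (m * c +_) e₂ ⟩
      m * c + m * S          ≡⟨ sym (*-distribˡ-+ m c S) ⟩
      m * (c + S)            ≡⟨ cong (m *_) (trans e₁ (sym e₃)) ⟩
      m * (nm + n)           ≡⟨ *-distribˡ-+ m nm n ⟩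
      m * nm + m * n         ≡⟨ cong (m * nm +_) (*-comm m n) ⟩
      m * nm + n * m  ∎
    mc+S'≡N : m * c + S' ≡ n * m
    mc+S'≡N = +-cancelˡ-≡ (m * nm) _ _ shifted

module Expansion (m : ℕ) .{{_ : NonZero m}} (n : ℕ) where
  open Characterisation m
  open ExpandContract m

  expand-isGrafting₀ : ∀ T → IsMGrafting m n T → IsGrafting (expand m T)
  expand-isGrafting₀ T (g , _ , ml) = expand-isGrafting 0 T g ml (mLabels⇒endsDivisible 0 T g ml)

  -- Its interval-poset is rise-contact-m-divisible: expanded labels and
  -- subtree ends are multiples of m.
  expand-riseContactDiv : ∀ T → IsMGrafting m n T → RiseContactDiv m (n * m) (graftInv (expand m T))
  expand-riseContactDiv T mg@(g , sz , ml) =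
    divisible⇒riseContactDiv (expand m T) (n * m) (expand-isGrafting₀ T mg) (trans (size-expand 0 T) sz) (n∣m*n n)
      (expand-labelsDivisible 0 T) (expand-endsDivisible 0 T (mLabels⇒endsDivisible 0 T g ml))

  contract-mGrafting : ∀ T → IsGrafting T → size T ≡ n * m → RiseContactDiv m (n * m) (graftInv T) →
                       IsMGrafting m n (contract m T) × expand m (contract m T) ≡ T
  contract-mGrafting T g sz rcd with riseContactDiv⇒divisible T (n * m) g sz rcd
  ... | labelsDiv , endsDiv =
    (contract-isGrafting 0 T g labelsDiv endsDiv , trans (size-contract 0 T) sz , contract-mLabels 0 T) ,
    expand-contract 0 T labelsDiv

  -- contacts(Graft⁻¹(expand T)) = m · contacts(Graft⁻¹(T)), computed on the
  -- lower trees, which are unique.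
  contacts-expand : ∀ T → IsMGrafting m n T → ∀ T₁ T₁' →
                    IsLower (graftInv T) (n * m) T₁ → IsLower (graftInv (expand m T)) (n * m) T₁' →
                    contacts (enc T₁') ≡ m * contacts (enc T₁)
  contacts-expand T mg@(g , sz , ml) T₁ T₁' isLower isLower' =
    contacts-scale n (contacts (enc T₁)) (labelSum T) (contacts (enc T₁')) (labelSum E) (nonMultipleNodes 0 T)
      (subst (λ B → contacts (enc B) + labelSum T ≡ n * m) (sym T₁≡) (trans (contacts-lowerTree T g) sz))
      (labelSum-expand 0 T ml) (nonMultipleNodes-total n T sz)
      (subst (λ B → contacts (enc B) + labelSum E ≡ n * m) (sym T₁'≡) (trans (contacts-lowerTree E gE) szE))
    where
    E : LT
    E = expand m T
    gE : IsGrafting E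
    gE = expand-isGrafting₀ T mg
    szE : size E ≡ n * m
    szE = trans (size-expand 0 T) sz
    T₁≡ : T₁ ≡ lowerTree T
    T₁≡ = uniqueLower isLower (subst (λ N → IsLower (graftInv T) N (lowerTree T)) sz (proj₁ (lowerUpperTrees T g)))
    T₁'≡ : T₁' ≡ lowerTree E
    T₁'≡ = uniqueLower isLower' (subst (λ N → IsLower (graftInv E) N (lowerTree E)) szE (proj₁ (lowerUpperTrees E gE)))

proposition5p16 : (m : ℕ) → .{{_ : NonZero m}} → (n : ℕ) →
    (∀ T → IsMGrafting m n T → IsGrafting (expand m T))
  × (∀ T → IsMGrafting m n T → RiseContactDiv m (n * m) (graftInv (expand m T)))
  × (∀ T → IsGrafting T → size T ≡ n * m → RiseContactDiv m (n * m) (graftInv T) →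
       IsMGrafting m n (contract m T) × expand m (contract m T) ≡ T)
  × (∀ T → IsMGrafting m n T → contract m (expand m T) ≡ T)
  × (∀ T → IsMGrafting m n T → ∀ T₁ T₁' →
       IsLower (graftInv T) (n * m) T₁ → IsLower (graftInv (expand m T)) (n * m) T₁' →
       contacts (enc T₁') ≡ m * contacts (enc T₁))
proposition5p16 m n =
    expand-isGrafting₀
  , expand-riseContactDiv
  , contract-mGrafting
  , (λ T (_ , _ , ml) → contract-expand 0 T ml)
  , contacts-expand
  where
  open Expansion m n
  open ExpandContract m using (contract-expand)
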